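{- Let $\mathcal{M}$ be a simple binary matroid on $[n]$, let $\mathbb{K}$ be a field, and let $C$ be a circuit of $\mathcal{M}$ with $k\ge4$ elements. The following are equivalent: (1) $C$ has a chord; (2) $\partial(e_C)\in\Im(\mathfrak{C}_{k-1})$; (3) $e_C\in\Im(\mathfrak{C}_{k-1})$.
   Context: A matroid is binary if it is representable over $\mathbb{Z}_2$ (equivalently, the symmetric difference of two distinct circuits contains a circuit). $\mathcal{E}=\bigwedge\big(\bigoplus_{i=1}^n\mathbb{K}e_i\big)$; $e_X=e_{i_1}\wedge\dots\wedge e_{i_m}$ for $X=\{i_1<\dots<i_m\}$; $\partial$ is the degree $-1$ derivation with $\partial(e_i)=1$ and $\partial(a\wedge b)=\partial(a)\wedge b+(-1)^{\deg a}a\wedge\partial(b)$. For $\mathfrak{X}\subseteq2^{[n]}$, $\Im(\mathfrak{X})$ is the two-sided ideal of $\mathcal{E}$ generated by $\{\partial(e_X):X\in\mathfrak{X}\}$. $\mathfrak{C}_{k-1}$ is the set of circuits of $\mathcal{M}$ with at most $k-1$ elements. A circuit $C$ has a chord $i_\alpha\in C$ if there are circuits $C_1,C_2$ with $C_1\cap C_2=\{i_\alpha\}$ and $C=C_1\Delta C_2$. -}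

module Defs where

open import Level using (Level; _⊔_) renaming (suc to lsuc)
open import Data.Nat using (ℕ; zero; suc; _≤_; _∸_; _≡ᵇ_)
open import Data.Bool using (Bool; true; false; if_then_else_; _xor_; not) renaming (_∧_ to _∧ᵇ_)
open import Data.Fin using (Fin)
open import Data.Fin.Subset using (Subset; _─_; _∈_; _∉_; _⊆_; _∩_; _∪_; ⁅_⁆; ∣_∣; ⊥)
open import Data.Vec using (Vec; []; _∷_; zipWith)
open import Data.List using (List; []; _∷_; map; _++_; foldr)
open import Data.Product using (Σ; ∃; _×_; _,_)
open import Data.List.Relation.Unary.All using (All)
open import Relation.Binary.PropositionalEquality using (_≡_; _≢_)
open import Relation.Nullary using (¬_)
open import Algebra.Bundles using (CommutativeRing)

record Field (c ℓ : Level) : Set (lsuc (c ⊔ ℓ)) where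
  field
    commutativeRing : CommutativeRing c ℓ
  open CommutativeRing commutativeRing public
  field
    1≉0     : ¬ (1# ≈ 0#)
    inverse : ∀ x → ¬ (x ≈ 0#) → Σ Carrier (λ y → (x * y) ≈ 1#)

_Δ_ : ∀ {n} → Subset n → Subset n → Subset n
_Δ_ = zipWith _xor_

allSubsets : ∀ n → List (Subset n)
allSubsets zero    = [] ∷ []
allSubsets (suc n) = map (true ∷_) (allSubsets n) ++ map (false ∷_) (allSubsets n)

-- inv X Y = #{(i , j) : i ∈ X, j ∈ Y, j < i}
inv : ∀ {n} → Subset n → Subset n → ℕ
inv []      []      = 0
inv (x ∷ X) (y ∷ Y) = (if y then ∣ X ∣ else 0) Data.Nat.+ inv X Y

eqS : ∀ {m} → Subset m → Subset m → Bool
eqS []       []       = true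
eqS (x ∷ xs) (y ∷ ys) = (if x then y else not y) ∧ᵇ eqS xs ys

subsetᵇ : ∀ {m} → Subset m → Subset m → Bool
subsetᵇ []       []       = true
subsetᵇ (x ∷ xs) (y ∷ ys) = (if x then y else true) ∧ᵇ subsetᵇ xs ys

record Matroid (n : ℕ) : Set₁ where
  field
    IsCircuit : Subset n → Set
    empty-not-circuit : ¬ IsCircuit ⊥
    incomparable : ∀ C₁ C₂ → IsCircuit C₁ → IsCircuit C₂ → C₁ ⊆ C₂ → C₁ ≡ C₂
    elimination : ∀ C₁ C₂ (e : Fin n) → IsCircuit C₁ → IsCircuit C₂ → C₁ ≢ C₂ →
                  e ∈ C₁ → e ∈ C₂ →
                  ∃ λ C₃ → IsCircuit C₃ × C₃ ⊆ (C₁ ∪ C₂) × e ∉ C₃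

module _ {n : ℕ} (M : Matroid n) where
  open Matroid M

  IsSimple : Set
  IsSimple = ∀ C → IsCircuit C → ¬ (∣ C ∣ ≡ 1) × ¬ (∣ C ∣ ≡ 2)

  IsBinary : Set
  IsBinary = ∀ C₁ C₂ → IsCircuit C₁ → IsCircuit C₂ → C₁ ≢ C₂ →
             ∃ λ C → IsCircuit C × C ⊆ (C₁ Δ C₂)

  HasChord : Subset n → Set
  HasChord C = ∃ λ (i : Fin n) → ∃ λ C₁ → ∃ λ C₂ →
               IsCircuit C₁ × IsCircuit C₂ × (C₁ ∩ C₂) ≡ ⁅ i ⁆ × C ≡ (C₁ Δ C₂)

  CircuitsUpTo : ℕ → Subset n → Set
  CircuitsUpTo m X = IsCircuit X × ∣ X ∣ ≤ m

-- The exterior algebra 𝓔 = ⋀ (⊕_{i ∈ [n]} 𝕂 e_i), an element being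
-- given by its coefficients in the basis (e_X)_{X ⊆ [n]}.

module Exterior {c ℓ : Level} (𝕂 : Field c ℓ) (n : ℕ) where
  open Field 𝕂

  𝓔 : Set c
  𝓔 = Subset n → Carrier

  _≋_ : 𝓔 → 𝓔 → Set ℓ
  a ≋ b = ∀ X → a X ≈ b X

  Σ-over : (Subset n → Carrier) → Carrier
  Σ-over f = foldr (λ X s → f X + s) 0# (allSubsets n)

  sgn : ℕ → Carrier
  sgn zero          = 1#
  sgn (suc zero)    = - 1#
  sgn (suc (suc m)) = sgn m

  -- a ∧ b : (a ∧ b)(Z) = Σ_{X ∩ Y = ∅, X ∪ Y = Z} (-1)^{inv X Y} a(X) b(Y),
  -- since e_X ∧ e_Y = (-1)^{inv X Y} e_{X ∪ Y} if X ∩ Y = ∅ and 0 otherwise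
  _∧_ : 𝓔 → 𝓔 → 𝓔
  (a ∧ b) Z = Σ-over λ X → Σ-over λ Y →
    if (eqS (X ∩ Y) ⊥ ∧ᵇ eqS (X ∪ Y) Z) then sgn (inv X Y) * (a X * b Y) else 0#

  e : Subset n → 𝓔
  e X Y = if eqS X Y then 1# else 0#

  -- the degree -1 derivation ∂ with ∂(e_i) = 1, written out on the basis:
  -- ∂(e_X) = Σ_{i ∈ X} (-1)^{#{j ∈ X : j < i}} e_{X ∖ {i}}, extended linearly.
  -- The coefficient of e_Z in ∂(a) is Σ over X = Z ⊎ {i} of
  -- (-1)^{#{j ∈ Z : j < i}} a(X)  (note #{j ∈ Z : j < i} = inv {i} Z).
  ∂ : 𝓔 → 𝓔
  ∂ a Z = Σ-over λ X →
    if (subsetᵇ Z X ∧ᵇ (∣ X ─ Z ∣ ≡ᵇ 1)) then sgn (inv (X ─ Z) Z) * a X else 0#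

  -- Im(𝔛): the two-sided ideal generated by {∂(e_X) : X ∈ 𝔛}, i.e. the
  -- finite sums Σ a_j ∧ ∂(e_{X_j}) ∧ b_j with X_j ∈ 𝔛.
  InIdeal : (Subset n → Set) → 𝓔 → Set (c ⊔ ℓ)
  InIdeal 𝔛 f = ∃ λ (gens : List (𝓔 × Subset n × 𝓔)) →
    All (λ { (_ , X , _) → 𝔛 X }) gens ×
    f ≋ foldr (λ { (a , X , b) s → λ Z → ((a ∧ ∂ (e X)) ∧ b) Z + s Z }) (λ _ → 0#) gens

{-# OPTIONS --safe #-}
module Submission where

-- Let C = C₁ Δ C₂ with C₁ ∩ C₂ = {i} and Pₖ = Cₖ ─ C₃₋ₖ. Then ∂ e_C = a₁ ∧ ∂ e_C₂ + a₂ ∧ ∂ e_C₁,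
-- where aₖ is a signed sum of the e_A with A a facet of Pₖ: at a facet of C exactly one of the two
-- terms survives, and at the remaining sets the two terms cancel by a parity count of inversions.
-- Likewise e_C is a multiple of e_P₁ ∧ ∂ e_C₂ up to monomials e_W with W ⊇ C₁ or W ⊇ C₂, and these
-- are multiples of e_A ∧ ∂ e_Cₖ. Conversely, ∂ e_X vanishes on all subsets of C unless ∣ X ─ C ∣ ≤ 1,
-- hence so does every element of an ideal generated by such ∂ e_X; as ∂ e_C and e_C do not vanish
-- below C, some circuit X smaller than C has ∣ X ─ C ∣ ≤ 1, and binarity together with circuit
-- elimination turns it into a chord of C.

open import Defs
open import Level using (Level)
open import Algebra.Bundles using (Monoid)
open import Data.Bool using (Bool; true; false; not; _xor_; if_then_else_; T) renaming (_∧_ to _∧ᵇ_; _∨_ to _∨ᵇ_)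
open import Data.Bool.Properties using (T-∧)
import Data.Bool.Properties as Boolₚ
open import Data.Empty using (⊥-elim)
open import Data.Fin using (Fin; zero; suc; #_)
open import Data.Fin.Subset using (Subset; _∈_; _∉_; _⊆_; _∩_; _∪_; _─_; ⁅_⁆; ∣_∣; ⊥; Nonempty)
open import Data.Fin.Subset.Properties
  using (in⊆in; out⊆; drop-∷-⊆; ⊆-refl; ⊆-trans; _⊆?_; p─q⊆p; p∩q⊆p; p∩q⊆q; ∩-comm; _∈?_; x∈⁅x⁆; x∈⁅y⁆⇒x≡y; ∉⊥;
         x∈p∩q⁺; x∈p∩q⁻; ∣⁅x⁆∣≡1; ∣⊥∣≡0; p⊆q⇒∣p∣≤∣q∣; nonempty?; Empty-unique)
open import Data.List using (List; []; _∷_; map; _++_; foldr)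
open import Data.List.Relation.Unary.All using (All; []; _∷_)
import Data.List.Relation.Unary.All.Properties as All
open import Data.Nat using (ℕ; zero; suc; _≤_; _≤?_; _∸_; _≡ᵇ_; z≤n; s≤s) renaming (_+_ to _+ℕ_; _*_ to _*ℕ_)
import Data.Nat.Properties as ℕ
open import Algebra.Properties.CommutativeSemigroup ℕ.+-commutativeSemigroup using () renaming (x∙yz≈y∙xz to x+[y+z]≡y+[x+z])
open import Data.Nat.Tactic.RingSolver using (solve-∀)
open import Data.Product using (∃-syntax; _×_; _,_; proj₁; proj₂; uncurry)
open import Data.Sum using (_⊎_; inj₁; inj₂)
import Data.Sum as Sum
open import Data.Unit using (tt)
open import Data.Vec using (Vec; []; _∷_; lookup; here)
import Data.Vec as Vec
open import Data.Vec.Properties using (lookup-zipWith; lookup-map; []=⇒lookup; lookup⇒[]=; ∷-injectiveʳ)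
open import Function using (_∘_; _∘′_)
open import Function.Bundles using (_⇔_; mk⇔; Equivalence)
open import Relation.Binary.PropositionalEquality as ≡ using (_≡_; _≢_; refl; cong; cong₂; subst)
open import Relation.Nullary using (¬_; yes; no; _⊎-dec_)
open import Relation.Nullary.Reflects using (Reflects; ofʸ; ofⁿ; _×-reflects_; fromEquivalence)
open import Relation.Unary using (Decidable)

private variable
  ℓ₁ ℓ₂ : Level
  S : Set ℓ₂
  m n : ℕ

Subset-ext : ∀ {p q : Subset n} → (∀ x → lookup p x ≡ lookup q x) → p ≡ q
Subset-ext {p = []}    {[]}    _ = refl
Subset-ext {p = _ ∷ _} {_ ∷ _} h = cong₂ _∷_ (h zero) (Subset-ext (h ∘ suc))

lookup-─ : ∀ (p q : Subset n) x → lookup (p ─ q) x ≡ lookup p x ∧ᵇ not (lookup q x)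
lookup-─ (b ∷ p) (true  ∷ q) zero    = ≡.sym (Boolₚ.∧-zeroʳ b)
lookup-─ (b ∷ p) (false ∷ q) zero    = ≡.sym (Boolₚ.∧-identityʳ b)
lookup-─ (_ ∷ p) (_     ∷ q) (suc x) = lookup-─ p q x

lookup-⊥ : ∀ x → lookup (⊥ {n}) x ≡ false
lookup-⊥ zero    = refl
lookup-⊥ (suc x) = lookup-⊥ x

if-reflects-true : ∀ {P : Set ℓ₁} {c : Bool} {x y : S} → Reflects P c → P → (if c then x else y) ≡ x
if-reflects-true (ofʸ _)  _ = refl
if-reflects-true (ofⁿ ¬p) p = ⊥-elim (¬p p)

if-reflects-false : ∀ {P : Set ℓ₁} {c : Bool} {x y : S} → Reflects P c → ¬ P → (if c then x else y) ≡ y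
if-reflects-false (ofʸ p) ¬p = ⊥-elim (¬p p)
if-reflects-false (ofⁿ _) _  = refl

reflects-cong : ∀ {P : Set ℓ₁} {Q : Set ℓ₂} {c d : Bool} → Reflects P c → Reflects Q d → (P → Q) → (Q → P) → c ≡ d
reflects-cong (ofʸ _) (ofʸ _)  _   _   = refl
reflects-cong (ofⁿ _) (ofⁿ _)  _   _   = refl
reflects-cong (ofʸ p) (ofⁿ ¬q) p⇒q _   = ⊥-elim (¬q (p⇒q p))
reflects-cong (ofⁿ ¬p) (ofʸ q) _   q⇒p = ⊥-elim (¬p (q⇒p q))

eqS-sound : ∀ (p q : Subset n) → T (eqS p q) → p ≡ q
eqS-sound []          []          _ = refl
eqS-sound (true  ∷ p) (true  ∷ q) t = cong (true ∷_) (eqS-sound p q t)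
eqS-sound (false ∷ p) (false ∷ q) t = cong (false ∷_) (eqS-sound p q t)
eqS-sound (true  ∷ p) (false ∷ q) ()
eqS-sound (false ∷ p) (true  ∷ q) ()

eqS-complete : ∀ {p q : Subset n} → p ≡ q → T (eqS p q)
eqS-complete {p = []}        refl = tt
eqS-complete {p = true  ∷ p} refl = eqS-complete {p = p} refl
eqS-complete {p = false ∷ p} refl = eqS-complete {p = p} refl

eqS-reflects : ∀ (p q : Subset n) → Reflects (p ≡ q) (eqS p q)
eqS-reflects p q = fromEquivalence (eqS-sound p q) eqS-complete

subsetᵇ-sound : ∀ (p q : Subset n) → T (subsetᵇ p q) → p ⊆ q
subsetᵇ-sound []          []          _ ()
subsetᵇ-sound (true  ∷ p) (true  ∷ q) t = in⊆in (subsetᵇ-sound p q t)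
subsetᵇ-sound (false ∷ p) (_     ∷ q) t = out⊆ (subsetᵇ-sound p q t)
subsetᵇ-sound (true  ∷ p) (false ∷ q) ()

subsetᵇ-complete : ∀ (p q : Subset n) → p ⊆ q → T (subsetᵇ p q)
subsetᵇ-complete []          []          _ = tt
subsetᵇ-complete (true  ∷ p) (true  ∷ q) s = subsetᵇ-complete p q (drop-∷-⊆ s)
subsetᵇ-complete (false ∷ p) (_     ∷ q) s = subsetᵇ-complete p q (drop-∷-⊆ s)
subsetᵇ-complete (true  ∷ p) (false ∷ q) s with s here
... | ()

subsetᵇ-reflects : ∀ (p q : Subset n) → Reflects (p ⊆ q) (subsetᵇ p q)
subsetᵇ-reflects p q = fromEquivalence (subsetᵇ-sound p q) (subsetᵇ-complete p q)

≡ᵇ-reflects : ∀ a b → Reflects (a ≡ b) (a ≡ᵇ b)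
≡ᵇ-reflects a b = fromEquivalence (ℕ.≡ᵇ⇒≡ a b) (ℕ.≡⇒≡ᵇ a b)

infix 4 _⋖_ _⋖ᵇ_

_⋖_ : Subset n → Subset n → Set
q ⋖ p = q ⊆ p × ∣ p ─ q ∣ ≡ 1

_⋖ᵇ_ : Subset n → Subset n → Bool
q ⋖ᵇ p = subsetᵇ q p ∧ᵇ (∣ p ─ q ∣ ≡ᵇ 1)

⋖-reflects : ∀ (q p : Subset n) → Reflects (q ⋖ p) (q ⋖ᵇ p)
⋖-reflects q p = subsetᵇ-reflects q p ×-reflects ≡ᵇ-reflects ∣ p ─ q ∣ 1

∣p∣≡0⇒p≡⊥ : ∀ (p : Subset n) → ∣ p ∣ ≡ 0 → p ≡ ⊥
∣p∣≡0⇒p≡⊥ []          _  = refl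
∣p∣≡0⇒p≡⊥ (false ∷ p) eq = cong (false ∷_) (∣p∣≡0⇒p≡⊥ p eq)

∣p∣≡1⇒p≡⁅x⁆ : ∀ (p : Subset n) → ∣ p ∣ ≡ 1 → ∃[ x ] p ≡ ⁅ x ⁆
∣p∣≡1⇒p≡⁅x⁆ (true  ∷ p) eq = zero , cong (true ∷_) (∣p∣≡0⇒p≡⊥ p (ℕ.suc-injective eq))
∣p∣≡1⇒p≡⁅x⁆ (false ∷ p) eq with ∣p∣≡1⇒p≡⁅x⁆ p eq
... | x , refl = suc x , refl

∣p∣≡1∧x∈p⇒p≡⁅x⁆ : ∀ (p : Subset n) {x} → ∣ p ∣ ≡ 1 → x ∈ p → p ≡ ⁅ x ⁆
∣p∣≡1∧x∈p⇒p≡⁅x⁆ p eq x∈p with ∣p∣≡1⇒p≡⁅x⁆ p eq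
... | y , refl = cong ⁅_⁆ (≡.sym (x∈⁅y⁆⇒x≡y y x∈p))

∣pΔq∣+2∣p∩q∣≡∣p∣+∣q∣ : ∀ (p q : Subset n) → ∣ p Δ q ∣ +ℕ 2 *ℕ ∣ p ∩ q ∣ ≡ ∣ p ∣ +ℕ ∣ q ∣
∣pΔq∣+2∣p∩q∣≡∣p∣+∣q∣ []          []          = refl
∣pΔq∣+2∣p∩q∣≡∣p∣+∣q∣ (false ∷ p) (false ∷ q) = ∣pΔq∣+2∣p∩q∣≡∣p∣+∣q∣ p q
∣pΔq∣+2∣p∩q∣≡∣p∣+∣q∣ (true  ∷ p) (false ∷ q) = cong suc (∣pΔq∣+2∣p∩q∣≡∣p∣+∣q∣ p q)
∣pΔq∣+2∣p∩q∣≡∣p∣+∣q∣ (false ∷ p) (true  ∷ q) =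
  ≡.trans (cong suc (∣pΔq∣+2∣p∩q∣≡∣p∣+∣q∣ p q)) (≡.sym (ℕ.+-suc ∣ p ∣ ∣ q ∣))
∣pΔq∣+2∣p∩q∣≡∣p∣+∣q∣ (true  ∷ p) (true  ∷ q) = begin
  ∣ p Δ q ∣ +ℕ 2 *ℕ suc ∣ p ∩ q ∣       ≡⟨ shift ∣ p Δ q ∣ ∣ p ∩ q ∣ ⟩
  suc (suc (∣ p Δ q ∣ +ℕ 2 *ℕ ∣ p ∩ q ∣)) ≡⟨ cong (λ k → suc (suc k)) (∣pΔq∣+2∣p∩q∣≡∣p∣+∣q∣ p q) ⟩
  suc (suc (∣ p ∣ +ℕ ∣ q ∣))            ≡⟨ cong suc (ℕ.+-suc ∣ p ∣ ∣ q ∣) ⟨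
  suc ∣ p ∣ +ℕ suc ∣ q ∣                ∎
  where
  open ≡.≡-Reasoning
  shift : ∀ a b → a +ℕ 2 *ℕ suc b ≡ suc (suc (a +ℕ 2 *ℕ b))
  shift = solve-∀

x∈p⇒⁅x⁆⊆p : ∀ {x} {p : Subset n} → x ∈ p → ⁅ x ⁆ ⊆ p
x∈p⇒⁅x⁆⊆p {x = x} x∈p y∈⁅x⁆ = subst (_∈ _) (≡.sym (x∈⁅y⁆⇒x≡y x y∈⁅x⁆)) x∈p

⁅x⁆⊆p⇒x∈p : ∀ {x} {p : Subset n} → ⁅ x ⁆ ⊆ p → x ∈ p
⁅x⁆⊆p⇒x∈p {x = x} ⁅x⁆⊆p = ⁅x⁆⊆p (x∈⁅x⁆ x)

x∉p⇒⁅x⁆∩p≡⊥ : ∀ {x} (p : Subset n) → x ∉ p → ⁅ x ⁆ ∩ p ≡ ⊥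
x∉p⇒⁅x⁆∩p≡⊥ {x = x} p x∉p = Empty-unique λ (y , y∈⁅x⁆∩p) →
  let y∈⁅x⁆ , y∈p = x∈p∩q⁻ ⁅ x ⁆ p y∈⁅x⁆∩p in x∉p (subst (_∈ p) (x∈⁅y⁆⇒x≡y x y∈⁅x⁆) y∈p)

⁅x⁆∩p≡⊥⇒x∉p : ∀ {x} (p : Subset n) → ⁅ x ⁆ ∩ p ≡ ⊥ → x ∉ p
⁅x⁆∩p≡⊥⇒x∉p {x = x} p ⁅x⁆∩p≡⊥ x∈p = ∉⊥ (subst (x ∈_) ⁅x⁆∩p≡⊥ (x∈p∩q⁺ (x∈⁅x⁆ x , x∈p)))

⋖⇒─≡⁅x⁆ : ∀ {p q : Subset n} → q ⋖ p → ∃[ x ] p ─ q ≡ ⁅ x ⁆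
⋖⇒─≡⁅x⁆ {p = p} {q} (_ , ∣p─q∣≡1) = ∣p∣≡1⇒p≡⁅x⁆ (p ─ q) ∣p─q∣≡1

⋖∧x∈p─q⇒─≡⁅x⁆ : ∀ {p q : Subset n} {x} → q ⋖ p → x ∈ p ─ q → p ─ q ≡ ⁅ x ⁆
⋖∧x∈p─q⇒─≡⁅x⁆ {p = p} {q} (_ , ∣p─q∣≡1) = ∣p∣≡1∧x∈p⇒p≡⁅x⁆ (p ─ q) ∣p─q∣≡1

─≡⁅x⁆⇒⋖ : ∀ {p q : Subset n} {x} → q ⊆ p → p ─ q ≡ ⁅ x ⁆ → q ⋖ p
─≡⁅x⁆⇒⋖ {x = x} q⊆p eq = q⊆p , ≡.trans (cong ∣_∣ eq) (∣⁅x⁆∣≡1 x)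

-- Boolean identities between subsets

module BooleanIdentities where

  infixr 9 _∩′_
  infixr 8 _∪′_ _Δ′_
  infixl 7 _─′_
  infix  5 _≐_ _⊑_

  data Expr (m : ℕ) : Set where
    var : Fin m → Expr m
    ∅   : Expr m
    _∩′_ _∪′_ _─′_ _Δ′_ : Expr m → Expr m → Expr m

  data Formula (m : ℕ) : Set where
    _≐_ _⊑_ : Expr m → Expr m → Formula m

  ⟦_⟧ : Expr m → Vec (Subset n) m → Subset n
  ⟦ var v  ⟧ ρ = lookup ρ v
  ⟦ ∅      ⟧ ρ = ⊥
  ⟦ a ∩′ b ⟧ ρ = ⟦ a ⟧ ρ ∩ ⟦ b ⟧ ρ
  ⟦ a ∪′ b ⟧ ρ = ⟦ a ⟧ ρ ∪ ⟦ b ⟧ ρ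
  ⟦ a ─′ b ⟧ ρ = ⟦ a ⟧ ρ ─ ⟦ b ⟧ ρ
  ⟦ a Δ′ b ⟧ ρ = ⟦ a ⟧ ρ Δ ⟦ b ⟧ ρ

  ⟦_⟧ᶠ : Formula m → Vec (Subset n) m → Set
  ⟦ a ≐ b ⟧ᶠ ρ = ⟦ a ⟧ ρ ≡ ⟦ b ⟧ ρ
  ⟦ a ⊑ b ⟧ᶠ ρ = ⟦ a ⟧ ρ ⊆ ⟦ b ⟧ ρ

  bit : Expr m → Vec Bool m → Bool
  bit (var v)  β = lookup β v
  bit ∅        β = false
  bit (a ∩′ b) β = bit a β ∧ᵇ bit b β
  bit (a ∪′ b) β = bit a β ∨ᵇ bit b β
  bit (a ─′ b) β = bit a β ∧ᵇ not (bit b β)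
  bit (a Δ′ b) β = bit a β xor bit b β

  bitᶠ : Formula m → Vec Bool m → Bool
  bitᶠ (a ≐ b) β = not (bit a β xor bit b β)
  bitᶠ (a ⊑ b) β = not (bit a β) ∨ᵇ bit b β

  column : Vec (Subset n) m → Fin n → Vec Bool m
  column ρ x = Vec.map (λ p → lookup p x) ρ

  lookup-⟦⟧ : ∀ (a : Expr m) (ρ : Vec (Subset n) m) x → lookup (⟦ a ⟧ ρ) x ≡ bit a (column ρ x)
  lookup-⟦⟧ (var v)  ρ x = ≡.sym (lookup-map v (λ p → lookup p x) ρ)
  lookup-⟦⟧ ∅        ρ x = lookup-⊥ x
  lookup-⟦⟧ (a ∩′ b) ρ x =
    ≡.trans (lookup-zipWith _∧ᵇ_ x (⟦ a ⟧ ρ) (⟦ b ⟧ ρ)) (cong₂ _∧ᵇ_ (lookup-⟦⟧ a ρ x) (lookup-⟦⟧ b ρ x))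
  lookup-⟦⟧ (a ∪′ b) ρ x =
    ≡.trans (lookup-zipWith _∨ᵇ_ x (⟦ a ⟧ ρ) (⟦ b ⟧ ρ)) (cong₂ _∨ᵇ_ (lookup-⟦⟧ a ρ x) (lookup-⟦⟧ b ρ x))
  lookup-⟦⟧ (a ─′ b) ρ x =
    ≡.trans (lookup-─ (⟦ a ⟧ ρ) (⟦ b ⟧ ρ) x) (cong₂ (λ u v → u ∧ᵇ not v) (lookup-⟦⟧ a ρ x) (lookup-⟦⟧ b ρ x))
  lookup-⟦⟧ (a Δ′ b) ρ x =
    ≡.trans (lookup-zipWith _xor_ x (⟦ a ⟧ ρ) (⟦ b ⟧ ρ)) (cong₂ _xor_ (lookup-⟦⟧ a ρ x) (lookup-⟦⟧ b ρ x))

  private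
    ≡⇒T-not-xor : ∀ {u v} → u ≡ v → T (not (u xor v))
    ≡⇒T-not-xor {true}  refl = tt
    ≡⇒T-not-xor {false} refl = tt

    T-not-xor⇒≡ : ∀ u v → T (not (u xor v)) → u ≡ v
    T-not-xor⇒≡ true  true  _ = refl
    T-not-xor⇒≡ false false _ = refl

    ⇒⇒T-implies : ∀ {u v} → (u ≡ true → v ≡ true) → T (not u ∨ᵇ v)
    ⇒⇒T-implies {false}         _ = tt
    ⇒⇒T-implies {true}  {true}  _ = tt
    ⇒⇒T-implies {true}  {false} h with h refl
    ... | ()

    T-implies⇒⇒ : ∀ u v → T (not u ∨ᵇ v) → u ≡ true → v ≡ true
    T-implies⇒⇒ true true _ _ = refl

  bitᶠ-sound : ∀ (φ : Formula m) (ρ : Vec (Subset n) m) → ⟦ φ ⟧ᶠ ρ → ∀ x → T (bitᶠ φ (column ρ x))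
  bitᶠ-sound (a ≐ b) ρ eq x = ≡⇒T-not-xor (≡.trans (≡.sym (lookup-⟦⟧ a ρ x))
                                          (≡.trans (cong (λ s → lookup s x) eq) (lookup-⟦⟧ b ρ x)))
  bitᶠ-sound (a ⊑ b) ρ sub x = ⇒⇒T-implies λ ax →
    ≡.trans (≡.sym (lookup-⟦⟧ b ρ x)) ([]=⇒lookup (sub (lookup⇒[]= x _ (≡.trans (lookup-⟦⟧ a ρ x) ax))))

  bitᶠ-complete : ∀ (φ : Formula m) (ρ : Vec (Subset n) m) → (∀ x → T (bitᶠ φ (column ρ x))) → ⟦ φ ⟧ᶠ ρ
  bitᶠ-complete (a ≐ b) ρ h = Subset-ext λ x →
    ≡.trans (lookup-⟦⟧ a ρ x) (≡.trans (T-not-xor⇒≡ _ _ (h x)) (≡.sym (lookup-⟦⟧ b ρ x)))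
  bitᶠ-complete (a ⊑ b) ρ h {x} x∈a = lookup⇒[]= x _ (≡.trans (lookup-⟦⟧ b ρ x)
    (T-implies⇒⇒ _ _ (h x) (≡.trans (≡.sym (lookup-⟦⟧ a ρ x)) ([]=⇒lookup x∈a))))

  Fact : Vec (Subset n) m → Set
  Fact {m = m} ρ = ∃[ φ ] ⟦_⟧ᶠ {m = m} φ ρ

  allHold : List (Formula m) → Vec Bool m → Bool
  allHold []       β = true
  allHold (φ ∷ φs) β = bitᶠ φ β ∧ᵇ allHold φs β

  everyAssignment : ∀ m → (Vec Bool m → Bool) → Bool
  everyAssignment zero    P = P []
  everyAssignment (suc m) P = everyAssignment m (P ∘ (true ∷_)) ∧ᵇ everyAssignment m (P ∘ (false ∷_))

  everyAssignment-sound : ∀ m P → T (everyAssignment m P) → ∀ β → T (P β)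
  everyAssignment-sound zero    P t []          = t
  everyAssignment-sound (suc m) P t (true  ∷ β) = everyAssignment-sound m _ (proj₁ (Equivalence.to T-∧ t)) β
  everyAssignment-sound (suc m) P t (false ∷ β) = everyAssignment-sound m _ (proj₂ (Equivalence.to T-∧ t)) β

  Tautology : List (Formula m) → Formula m → Bool
  Tautology {m = m} hyps φ = everyAssignment m λ β → not (allHold hyps β) ∨ᵇ bitᶠ φ β

  facts-hold : ∀ (ρ : Vec (Subset n) m) (fs : List (Fact ρ)) x → T (allHold (map proj₁ fs) (column ρ x))
  facts-hold ρ []              x = tt
  facts-hold ρ ((φ , pf) ∷ fs) x = Equivalence.from T-∧ (bitᶠ-sound φ ρ pf x , facts-hold ρ fs x)

  -- Sound because the set operations act pointwise: facts and goal are checked at every column of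
  -- truth values.
  prove : ∀ (ρ : Vec (Subset n) m) (fs : List (Fact ρ)) (φ : Formula m) →
          {T (Tautology (map proj₁ fs) φ)} → ⟦ φ ⟧ᶠ ρ
  prove {m = m} ρ fs φ {taut} = bitᶠ-complete φ ρ λ x →
    modusPonens (everyAssignment-sound m _ taut (column ρ x)) (facts-hold ρ fs x)
    where
    modusPonens : ∀ {u v} → T (not u ∨ᵇ v) → T u → T v
    modusPonens {true} t _ = t

open BooleanIdentities

split⇒─ : ∀ (p q r : Subset n) → p ∩ q ≡ ⊥ → p ∪ q ≡ r → q ≡ r ─ p
split⇒─ p q r disj cover =
  prove (p ∷ q ∷ r ∷ []) ((P ∩′ Q ≐ ∅ , disj) ∷ (P ∪′ Q ≐ R , cover) ∷ []) (Q ≐ R ─′ P)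
  where
  P Q R : Expr 3
  P = var (# 0); Q = var (# 1); R = var (# 2)

split⇒⊆ : ∀ (p q r : Subset n) → p ∩ q ≡ ⊥ → p ∪ q ≡ r → p ⊆ r
split⇒⊆ p q r disj cover =
  prove (p ∷ q ∷ r ∷ []) ((P ∩′ Q ≐ ∅ , disj) ∷ (P ∪′ Q ≐ R , cover) ∷ []) (P ⊑ R)
  where
  P Q R : Expr 3
  P = var (# 0); Q = var (# 1); R = var (# 2)

⊆⇒split : ∀ (p r : Subset n) → p ⊆ r → p ∩ (r ─ p) ≡ ⊥ × p ∪ (r ─ p) ≡ r
⊆⇒split {n} p r p⊆r = prove ρ hyp (P ∩′ (R ─′ P) ≐ ∅) , prove ρ hyp (P ∪′ (R ─′ P) ≐ R)
  where
  P R : Expr 2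
  P = var (# 0); R = var (# 1)
  ρ : Vec (Subset n) 2
  ρ = p ∷ r ∷ []
  hyp : List (Fact ρ)
  hyp = (P ⊑ R , p⊆r) ∷ []

⊆∧─≡⊥⇒≡ : ∀ (p r : Subset n) → p ⊆ r → r ─ p ≡ ⊥ → p ≡ r
⊆∧─≡⊥⇒≡ p r p⊆r r─p≡⊥ = prove (p ∷ r ∷ []) ((P ⊑ R , p⊆r) ∷ (R ─′ P ≐ ∅ , r─p≡⊥) ∷ []) (P ≐ R)
  where
  P R : Expr 2
  P = var (# 0); R = var (# 1)

p─p≡⊥ : ∀ (p : Subset n) → p ─ p ≡ ⊥
p─p≡⊥ p = prove (p ∷ []) [] (var (# 0) ─′ var (# 0) ≐ ∅)

-- Inversion counts

inv-⊥ʳ : ∀ (p : Subset n) → inv p ⊥ ≡ 0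
inv-⊥ʳ []      = refl
inv-⊥ʳ (_ ∷ p) = inv-⊥ʳ p

inv-∪ʳ : ∀ (p q r : Subset n) → q ∩ r ≡ ⊥ → inv p (q ∪ r) ≡ inv p q +ℕ inv p r
inv-∪ʳ []      []          []          _  = refl
inv-∪ʳ (_ ∷ p) (false ∷ q) (false ∷ r) qr = inv-∪ʳ p q r (∷-injectiveʳ qr)
inv-∪ʳ (_ ∷ p) (true  ∷ q) (false ∷ r) qr =
  ≡.trans (cong (∣ p ∣ +ℕ_) (inv-∪ʳ p q r (∷-injectiveʳ qr))) (≡.sym (ℕ.+-assoc ∣ p ∣ (inv p q) (inv p r)))
inv-∪ʳ (_ ∷ p) (false ∷ q) (true  ∷ r) qr =
  ≡.trans (cong (∣ p ∣ +ℕ_) (inv-∪ʳ p q r (∷-injectiveʳ qr))) (x+[y+z]≡y+[x+z] ∣ p ∣ (inv p q) (inv p r))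
inv-∪ʳ (_ ∷ p) (true  ∷ q) (true  ∷ r) ()

inv-swap : ∀ (p q : Subset n) → p ∩ q ≡ ⊥ → inv p q +ℕ inv q p ≡ ∣ p ∣ *ℕ ∣ q ∣
inv-swap []          []          _  = refl
inv-swap (false ∷ p) (false ∷ q) pq = inv-swap p q (∷-injectiveʳ pq)
inv-swap (true  ∷ p) (false ∷ q) pq =
  ≡.trans (x+[y+z]≡y+[x+z] (inv p q) ∣ q ∣ (inv q p)) (cong (∣ q ∣ +ℕ_) (inv-swap p q (∷-injectiveʳ pq)))
inv-swap (false ∷ p) (true  ∷ q) pq =
  ≡.trans (ℕ.+-assoc ∣ p ∣ (inv p q) (inv q p))
          (≡.trans (cong (∣ p ∣ +ℕ_) (inv-swap p q (∷-injectiveʳ pq))) (≡.sym (ℕ.*-suc ∣ p ∣ ∣ q ∣)))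
inv-swap (true  ∷ p) (true  ∷ q) ()

-- Sums over all subsets

module SubsetSums {c ℓ} (M : Monoid c ℓ) where
  open Monoid M renaming (refl to ≈-refl; sym to ≈-sym; trans to ≈-trans)

  sumOver : List (Subset m) → (Subset m → Carrier) → Carrier
  sumOver L f = foldr (λ X s → f X ∙ s) ε L

  sumOver-cong : ∀ (L : List (Subset m)) {f g} → (∀ X → f X ≈ g X) → sumOver L f ≈ sumOver L g
  sumOver-cong []      _ = ≈-refl
  sumOver-cong (X ∷ L) h = ∙-cong (h X) (sumOver-cong L h)

  sumOver-ε : ∀ (L : List (Subset m)) {f} → (∀ X → f X ≈ ε) → sumOver L f ≈ ε
  sumOver-ε []      _ = ≈-refl
  sumOver-ε (X ∷ L) h = ≈-trans (∙-cong (h X) (sumOver-ε L h)) (identityˡ ε)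

  sumOver-++ : ∀ (L L′ : List (Subset m)) f → sumOver (L ++ L′) f ≈ sumOver L f ∙ sumOver L′ f
  sumOver-++ []      L′ f = ≈-sym (identityˡ _)
  sumOver-++ (X ∷ L) L′ f = ≈-trans (∙-congˡ (sumOver-++ L L′ f)) (≈-sym (assoc _ _ _))

  sumOver-map : ∀ (g : Subset m → Subset n) (L : List (Subset m)) f → sumOver (map g L) f ≡ sumOver L (λ X → f (g X))
  sumOver-map g []      f = refl
  sumOver-map g (X ∷ L) f = cong (f (g X) ∙_) (sumOver-map g L f)

  sumOver-allSubsets-suc : ∀ f → sumOver (allSubsets (suc m)) f ≈
                           sumOver (allSubsets m) (f ∘ (true ∷_)) ∙ sumOver (allSubsets m) (f ∘ (false ∷_))
  sumOver-allSubsets-suc {m} f = ≈-trans (sumOver-++ (map (true ∷_) L) _ f)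
                                         (reflexive (cong₂ _∙_ (sumOver-map _ L f) (sumOver-map _ L f)))
    where
    L : List (Subset m)
    L = allSubsets m

  sumOver-allSubsets-single : ∀ (A : Subset m) f → (∀ X → X ≢ A → f X ≈ ε) → sumOver (allSubsets m) f ≈ f A
  sumOver-allSubsets-single {zero}  []          f _ = identityʳ _
  sumOver-allSubsets-single {suc m} (true ∷ A)  f h = ≈-trans (sumOver-allSubsets-suc f)
    (≈-trans (∙-cong (sumOver-allSubsets-single A _ λ X X≢A → h _ (X≢A ∘′ ∷-injectiveʳ))
                     (sumOver-ε (allSubsets m) λ X → h _ λ ()))
             (identityʳ _))
  sumOver-allSubsets-single {suc m} (false ∷ A) f h = ≈-trans (sumOver-allSubsets-suc f)
    (≈-trans (∙-cong (sumOver-ε (allSubsets m) λ X → h _ λ ())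
                     (sumOver-allSubsets-single A _ λ X X≢A → h _ (X≢A ∘′ ∷-injectiveʳ)))
             (identityˡ _))

-- The exterior algebra

module ExteriorCalculus {c ℓ} (𝕂 : Field c ℓ) (n : ℕ) where
  open Field 𝕂 renaming (refl to ≈-refl; sym to ≈-sym; trans to ≈-trans)
  open Exterior 𝕂 n
  open SubsetSums +-monoid
  open import Relation.Binary.Reasoning.Setoid setoid
  open import Algebra.Properties.Ring ring using (-1*x≈-x)
  open import Algebra.Properties.Group +-group using (⁻¹-involutive; ε⁻¹≈ε)

  private variable
    X Y Z W : Subset n

  Σ-over-cong : ∀ {f g} → (∀ X → f X ≈ g X) → Σ-over f ≈ Σ-over g
  Σ-over-cong = sumOver-cong (allSubsets n)

  Σ-over-0 : ∀ {f} → (∀ X → f X ≈ 0#) → Σ-over f ≈ 0#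
  Σ-over-0 = sumOver-ε (allSubsets n)

  Σ-over-single : ∀ A f → (∀ X → X ≢ A → f X ≈ 0#) → Σ-over f ≈ f A
  Σ-over-single = sumOver-allSubsets-single

  if-then-cong : ∀ (c : Bool) {x y} → x ≈ y → (if c then x else 0#) ≈ (if c then y else 0#)
  if-then-cong true  x≈y = x≈y
  if-then-cong false _   = ≈-refl

  if-then-≈0 : ∀ (c : Bool) {x} → x ≈ 0# → (if c then x else 0#) ≈ 0#
  if-then-≈0 true  x≈0 = x≈0
  if-then-≈0 false _   = ≈-refl

  x*[u*y]≈0 : ∀ x {u} y → u ≈ 0# → x * (u * y) ≈ 0#
  x*[u*y]≈0 x y u≈0 = ≈-trans (*-congˡ (≈-trans (*-congʳ u≈0) (zeroˡ y))) (zeroʳ x)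

  x*[y*u]≈0 : ∀ x y {u} → u ≈ 0# → x * (y * u) ≈ 0#
  x*[y*u]≈0 x y u≈0 = ≈-trans (*-congˡ (≈-trans (*-congˡ u≈0) (zeroʳ y))) (zeroʳ x)

  sgn-suc : ∀ k → sgn (suc k) ≈ - sgn k
  sgn-suc zero          = ≈-refl
  sgn-suc (suc zero)    = ≈-sym (⁻¹-involutive 1#)
  sgn-suc (suc (suc k)) = sgn-suc k

  sgn-+ : ∀ k l → sgn (k +ℕ l) ≈ sgn k * sgn l
  sgn-+ zero          l = ≈-sym (*-identityˡ _)
  sgn-+ (suc zero)    l = ≈-trans (sgn-suc l) (≈-sym (-1*x≈-x _))
  sgn-+ (suc (suc k)) l = sgn-+ k l

  sgn*sgn≈1 : ∀ k → sgn k * sgn k ≈ 1#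
  sgn*sgn≈1 zero          = *-identityˡ 1#
  sgn*sgn≈1 (suc zero)    = ≈-trans (-1*x≈-x _) (⁻¹-involutive 1#)
  sgn*sgn≈1 (suc (suc k)) = sgn*sgn≈1 k

  sgn≉0 : ∀ k → ¬ (sgn k ≈ 0#)
  sgn≉0 zero          = 1≉0
  sgn≉0 (suc zero)    -1≈0 = 1≉0 (≈-trans (≈-sym (⁻¹-involutive 1#)) (≈-trans (-‿cong -1≈0) ε⁻¹≈ε))
  sgn≉0 (suc (suc k)) = sgn≉0 k

  sgn-+-odd : ∀ k l j → k +ℕ l ≡ suc (j +ℕ j) → sgn k + sgn l ≈ 0#
  sgn-+-odd k l j k+l≡odd = ≈-trans (+-congʳ sgn-k≈-sgn-l) (-‿inverseˡ _)
    where
    sgn-k≈-sgn-l : sgn k ≈ - sgn l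
    sgn-k≈-sgn-l = begin
      sgn k                   ≈⟨ *-identityʳ _ ⟨
      sgn k * 1#              ≈⟨ *-congˡ (sgn*sgn≈1 l) ⟨
      sgn k * (sgn l * sgn l) ≈⟨ *-assoc _ _ _ ⟨
      (sgn k * sgn l) * sgn l ≈⟨ *-congʳ (sgn-+ k l) ⟨
      sgn (k +ℕ l) * sgn l     ≡⟨ cong (λ s → sgn s * sgn l) k+l≡odd ⟩
      sgn (suc (j +ℕ j)) * sgn l ≈⟨ *-congʳ (≈-trans (sgn-suc (j +ℕ j)) (-‿cong (≈-trans (sgn-+ j j) (sgn*sgn≈1 j)))) ⟩
      - 1# * sgn l            ≈⟨ -1*x≈-x _ ⟩
      - sgn l                 ∎

  sgn-sandwich : ∀ k l d → sgn k * ((sgn k * sgn l * d) * sgn l) ≈ d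
  sgn-sandwich k l d = begin
    s * ((s * s′ * d) * s′)     ≈⟨ *-congˡ (*-comm _ s′) ⟩
    s * (s′ * (s * s′ * d))     ≈⟨ *-assoc _ _ _ ⟨
    (s * s′) * (s * s′ * d)     ≈⟨ *-assoc _ _ _ ⟨
    ((s * s′) * (s * s′)) * d   ≈⟨ *-congʳ (*-cong (sgn-+ k l) (sgn-+ k l)) ⟨
    (sgn (k +ℕ l) * sgn (k +ℕ l)) * d ≈⟨ *-congʳ (sgn*sgn≈1 (k +ℕ l)) ⟩
    1# * d                      ≈⟨ *-identityˡ d ⟩
    d                           ∎
    where
    s s′ : Carrier
    s = sgn k; s′ = sgn l

  if*if≈0 : ∀ {P Q : Set} {b b′ x y} → Reflects P b → Reflects Q b′ → ¬ (P × Q) →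
            (if b then x else 0#) * (if b′ then y else 0#) ≈ 0#
  if*if≈0 (ofⁿ _) _       _   = zeroˡ _
  if*if≈0 (ofʸ _) (ofⁿ _) _   = zeroʳ _
  if*if≈0 (ofʸ p) (ofʸ q) ¬pq = ⊥-elim (¬pq (p , q))

  sgn-product : ∀ k₁ k₂ k₃ k₄ k₅ →
    sgn k₁ * ((sgn k₂ * (sgn k₃ * sgn k₄)) * sgn k₅) ≈ sgn (k₁ +ℕ (k₂ +ℕ (k₃ +ℕ k₄)) +ℕ k₅)
  sgn-product k₁ k₂ k₃ k₄ k₅ = ≈-sym (begin
    sgn (k₁ +ℕ (k₂ +ℕ (k₃ +ℕ k₄)) +ℕ k₅)                 ≈⟨ sgn-+ (k₁ +ℕ (k₂ +ℕ (k₃ +ℕ k₄))) k₅ ⟩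
    sgn (k₁ +ℕ (k₂ +ℕ (k₃ +ℕ k₄))) * sgn k₅
      ≈⟨ *-congʳ (≈-trans (sgn-+ k₁ _) (*-congˡ (≈-trans (sgn-+ k₂ _) (*-congˡ (sgn-+ k₃ k₄))))) ⟩
    (sgn k₁ * (sgn k₂ * (sgn k₃ * sgn k₄))) * sgn k₅     ≈⟨ *-assoc _ _ _ ⟩
    sgn k₁ * ((sgn k₂ * (sgn k₃ * sgn k₄)) * sgn k₅)     ∎)

  sgn-+-even : ∀ a k → sgn (a +ℕ (k +ℕ k)) ≈ sgn a
  sgn-+-even a k =
    ≈-trans (sgn-+ a (k +ℕ k)) (≈-trans (*-congˡ (≈-trans (sgn-+ k k) (sgn*sgn≈1 k))) (*-identityʳ _))

  e-diag : ∀ X → e X X ≡ 1#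
  e-diag X = if-reflects-true (eqS-reflects X X) refl

  e-offdiag : X ≢ Y → e X Y ≡ 0#
  e-offdiag {X} {Y} X≢Y = if-reflects-false (eqS-reflects X Y) X≢Y

  ∂-e : ∀ X Y → ∂ (e X) Y ≈ (if Y ⋖ᵇ X then sgn (inv (X ─ Y) Y) else 0#)
  ∂-e X Y = ≈-trans (Σ-over-single X _ off-X)
                    (if-then-cong (Y ⋖ᵇ X) (≈-trans (*-congˡ (reflexive (e-diag X))) (*-identityʳ _)))
    where
    off-X : ∀ X′ → X′ ≢ X → (if Y ⋖ᵇ X′ then sgn (inv (X′ ─ Y) Y) * e X X′ else 0#) ≈ 0#
    off-X X′ X′≢X = if-then-≈0 (Y ⋖ᵇ X′) (≈-trans (*-congˡ (reflexive (e-offdiag (X′≢X ∘′ ≡.sym)))) (zeroʳ _))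

  ∂-e-⋖ : Y ⋖ X → ∂ (e X) Y ≈ sgn (inv (X ─ Y) Y)
  ∂-e-⋖ {Y} {X} Y⋖X = ≈-trans (∂-e X Y) (reflexive (if-reflects-true (⋖-reflects Y X) Y⋖X))

  ∂-e-⋖̸ : ¬ Y ⋖ X → ∂ (e X) Y ≈ 0#
  ∂-e-⋖̸ {Y} {X} Y⋖̸X = ≈-trans (∂-e X Y) (reflexive (if-reflects-false (⋖-reflects Y X) Y⋖̸X))

  e-diag≉0 : ∀ X → ¬ (e X X ≈ 0#)
  e-diag≉0 X eXX≈0 = 1≉0 (≈-trans (reflexive (≡.sym (e-diag X))) eXX≈0)

  ∂-e-facet≉0 : ∀ {X j} → j ∈ X → ¬ (∂ (e X) (X ─ ⁅ j ⁆) ≈ 0#)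
  ∂-e-facet≉0 {X} {j} j∈X ∂eX≈0 = sgn≉0 (inv (X ─ (X ─ ⁅ j ⁆)) (X ─ ⁅ j ⁆)) (≈-trans (≈-sym (∂-e-⋖ X─j⋖X)) ∂eX≈0)
    where
    X─j⋖X : X ─ ⁅ j ⁆ ⋖ X
    X─j⋖X = ─≡⁅x⁆⇒⋖ (p─q⊆p X ⁅ j ⁆) (prove (X ∷ ⁅ j ⁆ ∷ []) ((ĵ ⊑ x , x∈p⇒⁅x⁆⊆p j∈X) ∷ []) (x ─′ (x ─′ ĵ) ≐ ĵ))
      where
      x ĵ : Expr 2
      x = var (# 0); ĵ = var (# 1)

  ∧-term : 𝓔 → 𝓔 → Subset n → Subset n → Carrier
  ∧-term a b Z X = if subsetᵇ X Z then sgn (inv X (Z ─ X)) * (a X * b (Z ─ X)) else 0#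

  ∧-expand : ∀ a b Z → (a ∧ b) Z ≈ Σ-over (∧-term a b Z)
  ∧-expand a b Z = Σ-over-cong λ X → ≈-trans (Σ-over-single (Z ─ X) _ (off-complement X))
    (reflexive (cong (λ c → if c then sgn (inv X (Z ─ X)) * (a X * b (Z ─ X)) else 0#)
      (reflects-cong (splits-reflects X (Z ─ X)) (subsetᵇ-reflects X Z)
                     (λ (disj , cover) → split⇒⊆ X (Z ─ X) Z disj cover) (⊆⇒split X Z))))
    where
    splits-reflects : ∀ X Y → Reflects (X ∩ Y ≡ ⊥ × X ∪ Y ≡ Z) (eqS (X ∩ Y) ⊥ ∧ᵇ eqS (X ∪ Y) Z)
    splits-reflects X Y = eqS-reflects (X ∩ Y) ⊥ ×-reflects eqS-reflects (X ∪ Y) Z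
    off-complement : ∀ X Y → Y ≢ Z ─ X →
      (if eqS (X ∩ Y) ⊥ ∧ᵇ eqS (X ∪ Y) Z then sgn (inv X Y) * (a X * b Y) else 0#) ≈ 0#
    off-complement X Y Y≢Z─X = reflexive (if-reflects-false (splits-reflects X Y)
      λ (disj , cover) → Y≢Z─X (split⇒─ X Y Z disj cover))

  ∧-vanishˡ : ∀ a b Z → (∀ X → X ⊆ Z → a X ≈ 0#) → (a ∧ b) Z ≈ 0#
  ∧-vanishˡ a b Z a≈0 = ≈-trans (∧-expand a b Z) (Σ-over-0 term≈0)
    where
    term≈0 : ∀ X → ∧-term a b Z X ≈ 0#
    term≈0 X with subsetᵇ X Z | subsetᵇ-reflects X Z
    ... | true  | ofʸ X⊆Z = x*[u*y]≈0 _ _ (a≈0 X X⊆Z)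
    ... | false | ofⁿ _   = ≈-refl

  ∧-vanishʳ : ∀ a b Z → (∀ Y → Y ⊆ Z → b Y ≈ 0#) → (a ∧ b) Z ≈ 0#
  ∧-vanishʳ a b Z b≈0 = ≈-trans (∧-expand a b Z) (Σ-over-0 term≈0)
    where
    term≈0 : ∀ X → ∧-term a b Z X ≈ 0#
    term≈0 X = if-then-≈0 (subsetᵇ X Z) (x*[y*u]≈0 _ _ (b≈0 (Z ─ X) (p─q⊆p Z X)))

  ∧-identityʳ : ∀ a Z → (a ∧ e ⊥) Z ≈ a Z
  ∧-identityʳ a Z = ≈-trans (∧-expand a (e ⊥) Z) (≈-trans (Σ-over-single Z _ off-Z) at-Z)
    where
    off-Z : ∀ X → X ≢ Z → ∧-term a (e ⊥) Z X ≈ 0#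
    off-Z X X≢Z with subsetᵇ X Z | subsetᵇ-reflects X Z
    ... | true  | ofʸ X⊆Z =
      x*[y*u]≈0 _ _ (reflexive (e-offdiag λ ⊥≡Z─X → X≢Z (⊆∧─≡⊥⇒≡ X Z X⊆Z (≡.sym ⊥≡Z─X))))
    ... | false | ofⁿ _   = ≈-refl
    at-Z : ∧-term a (e ⊥) Z Z ≈ a Z
    at-Z rewrite if-reflects-true {x = sgn (inv Z (Z ─ Z)) * (a Z * e ⊥ (Z ─ Z))} {y = 0#} (subsetᵇ-reflects Z Z) ⊆-refl
               | p─p≡⊥ Z | inv-⊥ʳ Z | e-diag (⊥ {n}) = ≈-trans (*-identityˡ _) (*-identityʳ _)

  infix 9 _·e_

  _·e_ : Carrier → Subset n → 𝓔
  (t ·e W) Z = if eqS W Z then t else 0#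

  ∧-expand-·eˡ : ∀ t A b Z → ((t ·e A) ∧ b) Z ≈ (if subsetᵇ A Z then sgn (inv A (Z ─ A)) * (t * b (Z ─ A)) else 0#)
  ∧-expand-·eˡ t A b Z = ≈-trans (∧-expand (t ·e A) b Z) (≈-trans (Σ-over-single A _ off-A)
    (reflexive (cong (λ s → if subsetᵇ A Z then sgn (inv A (Z ─ A)) * (s * b (Z ─ A)) else 0#)
                     (if-reflects-true (eqS-reflects A A) refl))))
    where
    off-A : ∀ X → X ≢ A → ∧-term (t ·e A) b Z X ≈ 0#
    off-A X X≢A = if-then-≈0 (subsetᵇ X Z) (x*[u*y]≈0 _ _ (reflexive (if-reflects-false (eqS-reflects A X) (X≢A ∘′ ≡.sym))))

  ∂-e-vanish-below : ∀ X C → 2 ≤ ∣ X ─ C ∣ → Y ⊆ C → ∂ (e X) Y ≈ 0#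
  ∂-e-vanish-below {Y} X C 2≤∣X─C∣ Y⊆C = ∂-e-⋖̸ {Y} {X} λ (_ , ∣X─Y∣≡1) →
    ℕ.<-irrefl ≡.refl (ℕ.≤-trans 2≤∣X─C∣ (≡.subst (∣ X ─ C ∣ ≤_) ∣X─Y∣≡1 (p⊆q⇒∣p∣≤∣q∣ X─C⊆X─Y)))
    where
    X─C⊆X─Y : X ─ C ⊆ X ─ Y
    X─C⊆X─Y = prove (X ∷ Y ∷ C ∷ []) ((y ⊑ z , Y⊆C) ∷ []) (x ─′ z ⊑ x ─′ y)
      where
      x y z : Expr 3
      x = var (# 0); y = var (# 1); z = var (# 2)

  ∧∂∧-vanish-below : ∀ a X b C → 2 ≤ ∣ X ─ C ∣ → Z ⊆ C → ((a ∧ ∂ (e X)) ∧ b) Z ≈ 0#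
  ∧∂∧-vanish-below {Z} a X b C 2≤∣X─C∣ Z⊆C = ∧-vanishˡ (a ∧ ∂ (e X)) b Z λ X′ X′⊆Z →
    ∧-vanishʳ a (∂ (e X)) X′ λ Y Y⊆X′ → ∂-e-vanish-below X C 2≤∣X─C∣ (⊆-trans Y⊆X′ (⊆-trans X′⊆Z Z⊆C))

  Generators : Set c
  Generators = List (𝓔 × Subset n × 𝓔)

  ⟦_⟧ᴳ : Generators → 𝓔
  ⟦_⟧ᴳ = foldr (λ { (a , X , b) s → λ Z → ((a ∧ ∂ (e X)) ∧ b) Z + s Z }) (λ _ → 0#)

  ⟦++⟧ᴳ : ∀ gs hs Z → ⟦ gs ++ hs ⟧ᴳ Z ≈ ⟦ gs ⟧ᴳ Z + ⟦ hs ⟧ᴳ Z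
  ⟦++⟧ᴳ []                hs Z = ≈-sym (+-identityˡ _)
  ⟦++⟧ᴳ ((a , X , b) ∷ gs) hs Z = ≈-trans (+-congˡ (⟦++⟧ᴳ gs hs Z)) (≈-sym (+-assoc _ _ _))

  module Ideal (𝔛 : Subset n → Set) where

    InIdeal-resp-≋ : ∀ {f g} → f ≋ g → InIdeal 𝔛 g → InIdeal 𝔛 f
    InIdeal-resp-≋ f≋g (gs , gs∈𝔛 , g≋gs) = gs , gs∈𝔛 , λ Z → ≈-trans (f≋g Z) (g≋gs Z)

    InIdeal-0 : InIdeal 𝔛 (λ _ → 0#)
    InIdeal-0 = [] , [] , λ _ → ≈-refl

    InIdeal-+ : ∀ {f g} → InIdeal 𝔛 f → InIdeal 𝔛 g → InIdeal 𝔛 (λ Z → f Z + g Z)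
    InIdeal-+ (gs , gs∈𝔛 , f≋gs) (hs , hs∈𝔛 , g≋hs) =
      gs ++ hs , All.++⁺ gs∈𝔛 hs∈𝔛 , λ Z → ≈-trans (+-cong (f≋gs Z) (g≋hs Z)) (≈-sym (⟦++⟧ᴳ gs hs Z))

    InIdeal-sumOver : ∀ L (F : Subset n → 𝓔) → (∀ W → InIdeal 𝔛 (F W)) → InIdeal 𝔛 (λ Z → sumOver L (λ W → F W Z))
    InIdeal-sumOver []      F F∈ = InIdeal-0
    InIdeal-sumOver (W ∷ L) F F∈ = InIdeal-+ (F∈ W) (InIdeal-sumOver L F F∈)

    InIdeal-∧∂ : ∀ a {X} → 𝔛 X → InIdeal 𝔛 (a ∧ ∂ (e X))
    InIdeal-∧∂ a {X} X∈𝔛 = (a , X , e ⊥) ∷ [] , X∈𝔛 ∷ [] ,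
      λ Z → ≈-trans (≈-sym (∧-identityʳ (a ∧ ∂ (e X)) Z)) (≈-sym (+-identityʳ _))

    generators-dichotomy : ∀ C gs → All (λ { (_ , X , _) → 𝔛 X }) gs →
                           (∃[ X ] 𝔛 X × ∣ X ─ C ∣ ≤ 1) ⊎ (∀ Z → Z ⊆ C → ⟦ gs ⟧ᴳ Z ≈ 0#)
    generators-dichotomy C []                 []             = inj₂ λ _ _ → ≈-refl
    generators-dichotomy C ((a , X , b) ∷ gs) (X∈𝔛 ∷ gs∈𝔛) with ∣ X ─ C ∣ ≤? 1
    ... | yes ∣X─C∣≤1 = inj₁ (X , X∈𝔛 , ∣X─C∣≤1)
    ... | no  ∣X─C∣≰1 = Sum.map₂ (λ vanish Z Z⊆C →
      ≈-trans (+-cong (∧∂∧-vanish-below a X b C (ℕ.≰⇒> ∣X─C∣≰1) Z⊆C) (vanish Z Z⊆C)) (+-identityʳ 0#))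
      (generators-dichotomy C gs gs∈𝔛)

    InIdeal-dichotomy : ∀ C {f} → InIdeal 𝔛 f → (∃[ X ] 𝔛 X × ∣ X ─ C ∣ ≤ 1) ⊎ (∀ Z → Z ⊆ C → f Z ≈ 0#)
    InIdeal-dichotomy C (gs , gs∈𝔛 , f≋gs) =
      Sum.map₂ (λ vanish Z Z⊆C → ≈-trans (f≋gs Z) (vanish Z Z⊆C)) (generators-dichotomy C gs gs∈𝔛)

    InIdeal-modulo : ∀ (U : Subset n → Set) → Decidable U → (∀ W → U W → ∀ d → InIdeal 𝔛 (d ·e W)) →
                     ∀ {f g} → InIdeal 𝔛 g → (∀ Z → ¬ U Z → f Z ≈ g Z) → InIdeal 𝔛 f
    InIdeal-modulo U U? U∈ {f} {g} g∈ f≈g = InIdeal-resp-≋ f≋g+correction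
      (InIdeal-+ g∈ (InIdeal-sumOver (allSubsets n) correction correction∈))
      where
      correction : Subset n → 𝓔
      correction W with U? W
      ... | yes _ = (f W - g W) ·e W
      ... | no  _ = λ _ → 0#

      correction∈ : ∀ W → InIdeal 𝔛 (correction W)
      correction∈ W with U? W
      ... | yes UW = U∈ W UW (f W - g W)
      ... | no  _  = InIdeal-0

      correction-off : ∀ Z W → W ≢ Z → correction W Z ≈ 0#
      correction-off Z W W≢Z with U? W
      ... | yes _ = reflexive (if-reflects-false (eqS-reflects W Z) W≢Z)
      ... | no  _ = ≈-refl

      corrected : ∀ Z → g Z + correction Z Z ≈ f Z
      corrected Z with U? Z
      ... | yes _ rewrite if-reflects-true {x = f Z - g Z} {y = 0#} (eqS-reflects Z Z) refl = begin
        g Z + (f Z - g Z)   ≈⟨ +-comm _ _ ⟩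
        (f Z - g Z) + g Z   ≈⟨ +-assoc _ _ _ ⟩
        f Z + (- g Z + g Z) ≈⟨ +-congˡ (-‿inverseˡ _) ⟩
        f Z + 0#            ≈⟨ +-identityʳ _ ⟩
        f Z                 ∎
      ... | no ¬UZ = ≈-trans (+-identityʳ _) (≈-sym (f≈g Z ¬UZ))

      f≋g+correction : f ≋ (λ Z → g Z + Σ-over (λ W → correction W Z))
      f≋g+correction Z = ≈-sym (≈-trans (+-congˡ (Σ-over-single Z _ (correction-off Z))) (corrected Z))

    -- d ·e W is a multiple of e_A ∧ ∂ e_X for A = (W ─ X) ∪ ⁅ j ⁆: only the term of ∂ e_X omitting j
    -- survives.
    InIdeal-·e : ∀ {X W j} → 𝔛 X → X ⊆ W → j ∈ X → ∀ d → InIdeal 𝔛 (d ·e W)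
    InIdeal-·e {X} {W} {j} X∈𝔛 X⊆W j∈X d = InIdeal-resp-≋ d·eW≋generator (InIdeal-∧∂ (t ·e A) X∈𝔛)
      where
      A : Subset n
      A = (W ─ X) ∪ ⁅ j ⁆
      ρ : Subset n → Vec (Subset n) 4
      ρ Z = W ∷ X ∷ ⁅ j ⁆ ∷ Z ∷ []
      w x ĵ z a : Expr 4
      w = var (# 0); x = var (# 1); ĵ = var (# 2); z = var (# 3)
      a = (w ─′ x) ∪′ ĵ
      facts : ∀ Z → List (Fact (ρ Z))
      facts Z = (x ⊑ w , X⊆W) ∷ (ĵ ⊑ x , x∈p⇒⁅x⁆⊆p j∈X) ∷ []

      A⊆W : A ⊆ W
      A⊆W = prove (ρ W) (facts W) (a ⊑ w)
      W─A⋖X : W ─ A ⋖ X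
      W─A⋖X = ─≡⁅x⁆⇒⋖ (prove (ρ W) (facts W) (w ─′ a ⊑ x)) (prove (ρ W) (facts W) (x ─′ (w ─′ a) ≐ ĵ))
      Z─A⋖X⇒Z≡W : ∀ Z → A ⊆ Z → Z ─ A ⋖ X → Z ≡ W
      Z─A⋖X⇒Z≡W Z A⊆Z Z─A⋖X@(Z─A⊆X , _) = prove (ρ Z)
        ((a ⊑ z , A⊆Z) ∷ (z ─′ a ⊑ x , Z─A⊆X) ∷ (x ─′ (z ─′ a) ≐ ĵ , X─[Z─A]≡⁅j⁆) ∷ facts Z) (z ≐ w)
        where
        X─[Z─A]≡⁅j⁆ : X ─ (Z ─ A) ≡ ⁅ j ⁆
        X─[Z─A]≡⁅j⁆ = ⋖∧x∈p─q⇒─≡⁅x⁆ Z─A⋖X (⁅x⁆⊆p⇒x∈p (prove (ρ Z) (facts Z) (ĵ ⊑ x ─′ (z ─′ a))))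

      k₁ k₂ : ℕ
      k₁ = inv A (W ─ A)
      k₂ = inv (X ─ (W ─ A)) (W ─ A)
      t : Carrier
      t = sgn k₁ * sgn k₂ * d

      d·eW≋generator : (d ·e W) ≋ ((t ·e A) ∧ ∂ (e X))
      d·eW≋generator Z = ≈-sym (≈-trans (∧-expand-·eˡ t A (∂ (e X)) Z) (compare Z))
        where
        compare : ∀ Z → (if subsetᵇ A Z then sgn (inv A (Z ─ A)) * (t * ∂ (e X) (Z ─ A)) else 0#) ≈ (d ·e W) Z
        compare Z with eqS W Z | eqS-reflects W Z
        ... | true | ofʸ refl
          rewrite if-reflects-true {x = sgn (inv A (W ─ A)) * (t * ∂ (e X) (W ─ A))} {y = 0#} (subsetᵇ-reflects A W) A⊆W =
          ≈-trans (*-congˡ (*-congˡ (∂-e-⋖ W─A⋖X))) (sgn-sandwich k₁ k₂ d)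
        ... | false | ofⁿ W≢Z with subsetᵇ A Z | subsetᵇ-reflects A Z
        ...   | true  | ofʸ A⊆Z = x*[y*u]≈0 _ _ (∂-e-⋖̸ λ Z─A⋖X → W≢Z (≡.sym (Z─A⋖X⇒Z≡W Z A⊆Z Z─A⋖X)))
        ...   | false | ofⁿ _   = ≈-refl

-- Chords

Adjacent : Subset n → Subset n → Subset n → Set
Adjacent P X Z = Z ∩ P ⋖ P × Z ─ P ⋖ X

sign-exponent : (A D R U Q S T : Subset n) → ℕ
sign-exponent A D R U Q S T = inv A D +ℕ (inv R U +ℕ (inv A Q +ℕ inv S Q)) +ℕ inv T D

sign-exponent-cong : ∀ {A D D′ R R′ U U′ Q Q′ S S′ T T′ : Subset n} →
  D ≡ D′ → R ≡ R′ → U ≡ U′ → Q ≡ Q′ → S ≡ S′ → T ≡ T′ →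
  sign-exponent A D R U Q S T ≡ sign-exponent A D′ R′ U′ Q′ S′ T′
sign-exponent-cong refl refl refl refl refl refl = refl

adjacency-exponent : Subset n → Subset n → Subset n → Subset n → ℕ
adjacency-exponent P Q X Z = sign-exponent (Z ∩ P) (Z ─ P) (P ─ (Z ∩ P)) ((Z ∩ P) ∪ Q) Q (X ─ Q) (X ─ (Z ─ P))

AdjacentAt : Subset n → Subset n → Subset n → Fin n → Fin n → Set
AdjacentAt P X Z c c′ = P ─ (Z ∩ P) ≡ ⁅ c ⁆ × Z ─ P ⊆ X × X ─ (Z ─ P) ≡ ⁅ c′ ⁆

Adjacent⇒AdjacentAt : ∀ {P X Z : Subset n} → Adjacent P X Z → ∃[ c ] ∃[ c′ ] AdjacentAt P X Z c c′
Adjacent⇒AdjacentAt (Z∩P⋖P , Z─P⋖X@(Z─P⊆X , _)) with ⋖⇒─≡⁅x⁆ Z∩P⋖P | ⋖⇒─≡⁅x⁆ Z─P⋖X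
... | c , P─Z∩P≡⁅c⁆ | c′ , X─[Z─P]≡⁅c′⁆ = c , c′ , P─Z∩P≡⁅c⁆ , Z─P⊆X , X─[Z─P]≡⁅c′⁆

AdjacentAt⇒Adjacent : ∀ {P X Z : Subset n} {c c′} → AdjacentAt P X Z c c′ → Adjacent P X Z
AdjacentAt⇒Adjacent {P = P} {Z = Z} (P─Z∩P≡⁅c⁆ , Z─P⊆X , X─[Z─P]≡⁅c′⁆) =
  ─≡⁅x⁆⇒⋖ (p∩q⊆q Z P) P─Z∩P≡⁅c⁆ , ─≡⁅x⁆⇒⋖ Z─P⊆X X─[Z─P]≡⁅c′⁆

record Separated (A B : Subset n) (c c′ i : Fin n) : Set where
  field
    A∩B  : A ∩ B ≡ ⊥
    A∩c  : A ∩ ⁅ c ⁆ ≡ ⊥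
    A∩c′ : A ∩ ⁅ c′ ⁆ ≡ ⊥
    A∩i  : A ∩ ⁅ i ⁆ ≡ ⊥
    B∩c  : B ∩ ⁅ c ⁆ ≡ ⊥
    B∩c′ : B ∩ ⁅ c′ ⁆ ≡ ⊥
    B∩i  : B ∩ ⁅ i ⁆ ≡ ⊥
    c∩c′ : ⁅ c ⁆ ∩ ⁅ c′ ⁆ ≡ ⊥
    c∩i  : ⁅ c ⁆ ∩ ⁅ i ⁆ ≡ ⊥
    c′∩i : ⁅ c′ ⁆ ∩ ⁅ i ⁆ ≡ ⊥

-- adjacency-exponent P₁ P₂ C₂ Z written in the blocks Z = A ∪ B ∪ ⁅ i ⁆, P₁ = A ∪ ⁅ c ⁆, P₂ = B ∪ ⁅ c′ ⁆.
decomposed-exponent : Subset n → Subset n → Fin n → Fin n → Fin n → ℕ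
decomposed-exponent A B c c′ i = sign-exponent A (B ∪ ⁅ i ⁆) ⁅ c ⁆ (A ∪ (B ∪ ⁅ c′ ⁆)) (B ∪ ⁅ c′ ⁆) ⁅ i ⁆ ⁅ c′ ⁆

Separated-swap : ∀ {A B : Subset n} {c c′ i} → Separated A B c c′ i → Separated B A c′ c i
Separated-swap {A = A} {B} {c} {c′} s = record
  { A∩B = ≡.trans (∩-comm B A) A∩B ; A∩c = B∩c′ ; A∩c′ = B∩c ; A∩i = B∩i
  ; B∩c = A∩c′ ; B∩c′ = A∩c ; B∩i = A∩i ; c∩c′ = ≡.trans (∩-comm ⁅ c′ ⁆ ⁅ c ⁆) c∩c′
  ; c∩i = c′∩i ; c′∩i = c∩i }
  where open Separated s

private
  ∩-∪-⊥ : ∀ (p q r : Subset n) → p ∩ q ≡ ⊥ → p ∩ r ≡ ⊥ → p ∩ (q ∪ r) ≡ ⊥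
  ∩-∪-⊥ p q r pq pr =
    prove (p ∷ q ∷ r ∷ []) ((x ∩′ y ≐ ∅ , pq) ∷ (x ∩′ z ≐ ∅ , pr) ∷ []) (x ∩′ (y ∪′ z) ≐ ∅)
    where
    x y z : Expr 3
    x = var (# 0); y = var (# 1); z = var (# 2)

  inv-swap-⁅⁆ : ∀ (p : Subset n) x → p ∩ ⁅ x ⁆ ≡ ⊥ → inv p ⁅ x ⁆ +ℕ inv ⁅ x ⁆ p ≡ ∣ p ∣
  inv-swap-⁅⁆ p x p∩x =
    ≡.trans (inv-swap p ⁅ x ⁆ p∩x) (≡.trans (cong (∣ p ∣ *ℕ_) (∣⁅x⁆∣≡1 x)) (ℕ.*-identityʳ ∣ p ∣))

decomposed-exponent-expand : ∀ {A B : Subset n} {c c′ i} → Separated A B c c′ i →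
  let I = ⁅ i ⁆; Ĉ = ⁅ c ⁆; Ĉ′ = ⁅ c′ ⁆ in
  decomposed-exponent A B c c′ i ≡
    (inv A B +ℕ inv A I) +ℕ ((inv Ĉ A +ℕ (inv Ĉ B +ℕ inv Ĉ Ĉ′)) +ℕ ((inv A B +ℕ inv A Ĉ′) +ℕ (inv I B +ℕ inv I Ĉ′)))
      +ℕ (inv Ĉ′ B +ℕ inv Ĉ′ I)
decomposed-exponent-expand {n} {A} {B} {c} {c′} {i} s =
  cong₂ _+ℕ_ (cong₂ _+ℕ_ (inv-∪ʳ A B I B∩i)
                         (cong₂ _+ℕ_ (≡.trans (inv-∪ʳ Ĉ A (B ∪ Ĉ′) (∩-∪-⊥ A B Ĉ′ A∩B A∩c′))
                                               (cong (inv Ĉ A +ℕ_) (inv-∪ʳ Ĉ B Ĉ′ B∩c′)))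
                                     (cong₂ _+ℕ_ (inv-∪ʳ A B Ĉ′ B∩c′) (inv-∪ʳ I B Ĉ′ B∩c′))))
             (inv-∪ʳ Ĉ′ B I B∩i)
  where
  open Separated s
  I Ĉ Ĉ′ : Subset n
  I = ⁅ i ⁆; Ĉ = ⁅ c ⁆; Ĉ′ = ⁅ c′ ⁆

decomposed-exponent-odd : ∀ {A B : Subset n} {c c′ i} → Separated A B c c′ i →
  ∃[ K ] decomposed-exponent A B c c′ i +ℕ decomposed-exponent B A c′ c i ≡ suc (K +ℕ K)
decomposed-exponent-odd {n} {A} {B} {c} {c′} {i} s = ∣ A ∣ +ℕ ∣ B ∣ +ℕ 1 +ℕ K₀ , (begin
  decomposed-exponent A B c c′ i +ℕ decomposed-exponent B A c′ c i
    ≡⟨ cong₂ _+ℕ_ (decomposed-exponent-expand s) (decomposed-exponent-expand (Separated-swap s)) ⟩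
  _ ≡⟨ regroup (inv A B) (inv A I) (inv Ĉ A) (inv Ĉ B) (inv Ĉ Ĉ′) (inv A Ĉ′) (inv I B) (inv I Ĉ′) (inv Ĉ′ B) (inv Ĉ′ I)
               (inv B A) (inv B I) (inv Ĉ′ A) (inv Ĉ′ Ĉ) (inv B Ĉ) (inv I A) (inv I Ĉ) (inv Ĉ I) ⟩
  (inv A I +ℕ inv I A) +ℕ (inv B I +ℕ inv I B) +ℕ (inv B Ĉ +ℕ inv Ĉ B) +ℕ (inv A Ĉ′ +ℕ inv Ĉ′ A)
    +ℕ (inv Ĉ Ĉ′ +ℕ inv Ĉ′ Ĉ) +ℕ (inv Ĉ′ I +ℕ inv I Ĉ′) +ℕ (inv Ĉ I +ℕ inv I Ĉ) +ℕ 2 *ℕ K₀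
    ≡⟨ cong (_+ℕ 2 *ℕ K₀) (cong₂ _+ℕ_ (cong₂ _+ℕ_ (cong₂ _+ℕ_ (cong₂ _+ℕ_ (cong₂ _+ℕ_ (cong₂ _+ℕ_
         (inv-swap-⁅⁆ A i A∩i) (inv-swap-⁅⁆ B i B∩i)) (inv-swap-⁅⁆ B c B∩c)) (inv-swap-⁅⁆ A c′ A∩c′))
         (singletons c∩c′)) (singletons c′∩i)) (singletons c∩i)) ⟩
  ∣ A ∣ +ℕ ∣ B ∣ +ℕ ∣ B ∣ +ℕ ∣ A ∣ +ℕ 1 +ℕ 1 +ℕ 1 +ℕ 2 *ℕ K₀
    ≡⟨ tidy ∣ A ∣ ∣ B ∣ K₀ ⟩
  suc ((∣ A ∣ +ℕ ∣ B ∣ +ℕ 1 +ℕ K₀) +ℕ (∣ A ∣ +ℕ ∣ B ∣ +ℕ 1 +ℕ K₀)) ∎)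
  where
  open ≡.≡-Reasoning
  open Separated s
  I Ĉ Ĉ′ : Subset n
  I = ⁅ i ⁆; Ĉ = ⁅ c ⁆; Ĉ′ = ⁅ c′ ⁆
  K₀ : ℕ
  K₀ = inv A B +ℕ inv B A +ℕ inv Ĉ A +ℕ inv Ĉ′ B

  singletons : ∀ {x y : Fin n} → ⁅ x ⁆ ∩ ⁅ y ⁆ ≡ ⊥ → inv ⁅ x ⁆ ⁅ y ⁆ +ℕ inv ⁅ y ⁆ ⁅ x ⁆ ≡ 1
  singletons {x = x} {y = y} x∩y = ≡.trans (inv-swap-⁅⁆ ⁅ x ⁆ y x∩y) (∣⁅x⁆∣≡1 x)

  regroup : ∀ AB AI cA cB cc′ Ac′ IB Ic′ c′B c′I BA BI c′A c′c Bc IA Ic cI →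
    ((AB +ℕ AI) +ℕ ((cA +ℕ (cB +ℕ cc′)) +ℕ ((AB +ℕ Ac′) +ℕ (IB +ℕ Ic′))) +ℕ (c′B +ℕ c′I)) +ℕ
    ((BA +ℕ BI) +ℕ ((c′B +ℕ (c′A +ℕ c′c)) +ℕ ((BA +ℕ Bc) +ℕ (IA +ℕ Ic))) +ℕ (cA +ℕ cI))
    ≡ (AI +ℕ IA) +ℕ (BI +ℕ IB) +ℕ (Bc +ℕ cB) +ℕ (Ac′ +ℕ c′A) +ℕ (cc′ +ℕ c′c) +ℕ (c′I +ℕ Ic′) +ℕ (cI +ℕ Ic)
      +ℕ 2 *ℕ (AB +ℕ BA +ℕ cA +ℕ c′B)
  regroup = solve-∀

  tidy : ∀ a b k → a +ℕ b +ℕ b +ℕ a +ℕ 1 +ℕ 1 +ℕ 1 +ℕ 2 *ℕ k ≡ suc ((a +ℕ b +ℕ 1 +ℕ k) +ℕ (a +ℕ b +ℕ 1 +ℕ k))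
  tidy = solve-∀

module ChordSets {n} (C₁ C₂ : Subset n) (i : Fin n) (C : Subset n)
                 (C₁∩C₂≡⁅i⁆ : C₁ ∩ C₂ ≡ ⁅ i ⁆) (C≡C₁ΔC₂ : C ≡ C₁ Δ C₂) where

  P₁ P₂ : Subset n
  P₁ = C₁ ─ C₂
  P₂ = C₂ ─ C₁

  private
    ρ : Subset n → Fin n → Fin n → Vec (Subset n) 7
    ρ Z c c′ = C₁ ∷ C₂ ∷ ⁅ i ⁆ ∷ Z ∷ ⁅ c ⁆ ∷ ⁅ c′ ⁆ ∷ C ∷ []

    c₁ c₂ ı z ĉ ĉ′ cc p₁ p₂ : Expr 7
    c₁ = var (# 0); c₂ = var (# 1); ı = var (# 2); z = var (# 3)
    ĉ = var (# 4); ĉ′ = var (# 5); cc = var (# 6)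
    p₁ = c₁ ─′ c₂; p₂ = c₂ ─′ c₁

    chord : ∀ {Z c c′} → List (Fact (ρ Z c c′))
    chord = (c₁ ∩′ c₂ ≐ ı , C₁∩C₂≡⁅i⁆) ∷ (cc ≐ c₁ Δ′ c₂ , C≡C₁ΔC₂) ∷ []

    on-facet : ∀ {Z c} → Z ⊆ C → C ─ Z ≡ ⁅ c ⁆ → List (Fact (ρ Z c c))
    on-facet Z⊆C C─Z≡⁅c⁆ = (z ⊑ cc , Z⊆C) ∷ (cc ─′ z ≐ ĉ , C─Z≡⁅c⁆) ∷ chord

  i∈C₁ : i ∈ C₁
  i∈C₁ = ⁅x⁆⊆p⇒x∈p (prove (ρ C i i) chord (ı ⊑ c₁))

  i∈C₂ : i ∈ C₂
  i∈C₂ = ⁅x⁆⊆p⇒x∈p (prove (ρ C i i) chord (ı ⊑ c₂))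

  P₁∩C₂≡⊥ : P₁ ∩ C₂ ≡ ⊥
  P₁∩C₂≡⊥ = prove (ρ C i i) chord (p₁ ∩′ c₂ ≐ ∅)

  C₂∩C₁≡⁅i⁆ : C₂ ∩ C₁ ≡ ⁅ i ⁆
  C₂∩C₁≡⁅i⁆ = prove (ρ C i i) chord (c₂ ∩′ c₁ ≐ ı)

  C≡C₂ΔC₁ : C ≡ C₂ Δ C₁
  C≡C₂ΔC₁ = prove (ρ C i i) chord (cc ≐ c₂ Δ′ c₁)

  facet-side : ∀ {Z c} → Z ⊆ C → C ─ Z ≡ ⁅ c ⁆ → c ∉ C₁ → c ∈ C₂
  facet-side {Z} {c} Z⊆C C─Z≡⁅c⁆ c∉C₁ =
    ⁅x⁆⊆p⇒x∈p (prove (ρ Z c c) ((ĉ ∩′ c₁ ≐ ∅ , x∉p⇒⁅x⁆∩p≡⊥ C₁ c∉C₁) ∷ on-facet Z⊆C C─Z≡⁅c⁆)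
                     (ĉ ⊑ c₂))

  facet-adjacent : ∀ {Z c} → Z ⊆ C → C ─ Z ≡ ⁅ c ⁆ → c ∈ C₁ → Adjacent P₁ C₂ Z
  facet-adjacent {Z} {c} Z⊆C C─Z≡⁅c⁆ c∈C₁ = AdjacentAt⇒Adjacent {c = c} {c′ = i}
    (prove (ρ Z c c) fs (p₁ ─′ z ∩′ p₁ ≐ ĉ) , prove (ρ Z c c) fs (z ─′ p₁ ⊑ c₂) ,
     prove (ρ Z c c) fs (c₂ ─′ (z ─′ p₁) ≐ ı))
    where
    fs : List (Fact (ρ Z c c))
    fs = (ĉ ⊑ c₁ , x∈p⇒⁅x⁆⊆p c∈C₁) ∷ on-facet Z⊆C C─Z≡⁅c⁆

  facet-exponent : ∀ {Z c} → Z ⊆ C → C ─ Z ≡ ⁅ c ⁆ → c ∈ C₁ →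
                   ∃[ k ] adjacency-exponent P₁ P₂ C₂ Z ≡ inv (C ─ Z) Z +ℕ (k +ℕ k)
  facet-exponent {Z} {c} Z⊆C C─Z≡⁅c⁆ c∈C₁ = inv A P₂ +ℕ inv ⁅ i ⁆ P₂ , ≡.trans
    (sign-exponent-cong {A = A} (prove ρ′ fs (z ─′ p₁ ≐ p₂)) (prove ρ′ fs (p₁ ─′ z ∩′ p₁ ≐ cc ─′ z))
                        (prove ρ′ fs (z ∩′ p₁ ∪′ p₂ ≐ z)) refl (prove ρ′ fs (c₂ ─′ p₂ ≐ ı))
                        (prove ρ′ fs (c₂ ─′ (z ─′ p₁) ≐ ı)))
    (regroup (inv A P₂) (inv (C ─ Z) Z) (inv ⁅ i ⁆ P₂))
    where
    A : Subset n
    A = Z ∩ P₁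
    ρ′ : Vec (Subset n) 7
    ρ′ = ρ Z c c
    fs : List (Fact ρ′)
    fs = (ĉ ⊑ c₁ , x∈p⇒⁅x⁆⊆p c∈C₁) ∷ on-facet Z⊆C C─Z≡⁅c⁆
    regroup : ∀ a y w → a +ℕ (y +ℕ (a +ℕ w)) +ℕ w ≡ y +ℕ ((a +ℕ w) +ℕ (a +ℕ w))
    regroup = solve-∀

  facet-nonadjacent : ∀ {Z c} → Z ⊆ C → C ─ Z ≡ ⁅ c ⁆ → c ∈ C₂ → ¬ Adjacent P₁ C₂ Z
  facet-nonadjacent {Z} {c} Z⊆C C─Z≡⁅c⁆ c∈C₂ ((_ , ∣P₁─Z∩P₁∣≡1) , _) = 0≢1 (begin
    0                   ≡⟨ ∣⊥∣≡0 n ⟨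
    ∣ ⊥ {n} ∣           ≡⟨ cong ∣_∣ P₁─Z∩P₁≡⊥ ⟨
    ∣ P₁ ─ (Z ∩ P₁) ∣   ≡⟨ ∣P₁─Z∩P₁∣≡1 ⟩
    1                   ∎)
    where
    open ≡.≡-Reasoning
    P₁─Z∩P₁≡⊥ : P₁ ─ (Z ∩ P₁) ≡ ⊥
    P₁─Z∩P₁≡⊥ =
      prove (ρ Z c c) ((ĉ ⊑ c₂ , x∈p⇒⁅x⁆⊆p c∈C₂) ∷ on-facet Z⊆C C─Z≡⁅c⁆) (p₁ ─′ z ∩′ p₁ ≐ ∅)
    0≢1 : 0 ≢ 1
    0≢1 ()

  adjacent⇒⋖ : ∀ {Z} → i ∉ Z → Adjacent P₁ C₂ Z → Z ⋖ C
  adjacent⇒⋖ {Z} i∉Z adj@(_ , Z─P₁⋖C₂) with Adjacent⇒AdjacentAt adj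
  ... | c , c′ , P₁─Z∩P₁≡⁅c⁆ , Z─P₁⊆C₂ , _ =
    ─≡⁅x⁆⇒⋖ (prove (ρ Z c i) fs (z ⊑ cc)) (prove (ρ Z c i) fs (cc ─′ z ≐ ĉ))
    where
    i∉Z-fact : ∀ {c c′} → Fact (ρ Z c c′)
    i∉Z-fact = ı ∩′ z ≐ ∅ , x∉p⇒⁅x⁆∩p≡⊥ Z i∉Z
    C₂─[Z─P₁]≡⁅i⁆ : C₂ ─ (Z ─ P₁) ≡ ⁅ i ⁆
    C₂─[Z─P₁]≡⁅i⁆ = ⋖∧x∈p─q⇒─≡⁅x⁆ Z─P₁⋖C₂
      (⁅x⁆⊆p⇒x∈p (prove (ρ Z i i) (i∉Z-fact ∷ chord) (ı ⊑ c₂ ─′ (z ─′ p₁))))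
    fs : List (Fact (ρ Z c i))
    fs = (p₁ ─′ z ∩′ p₁ ≐ ĉ , P₁─Z∩P₁≡⁅c⁆) ∷ (z ─′ p₁ ⊑ c₂ , Z─P₁⊆C₂)
       ∷ (c₂ ─′ (z ─′ p₁) ≐ ı , C₂─[Z─P₁]≡⁅i⁆) ∷ i∉Z-fact ∷ chord

  module _ {Z c c′} (i∈Z : i ∈ Z) (at : AdjacentAt P₁ C₂ Z c c′) where
    private
      P₁─Z∩P₁≡⁅c⁆ : P₁ ─ (Z ∩ P₁) ≡ ⁅ c ⁆
      P₁─Z∩P₁≡⁅c⁆ = proj₁ at
      Z─P₁⊆C₂ : Z ─ P₁ ⊆ C₂
      Z─P₁⊆C₂ = proj₁ (proj₂ at)
      C₂─[Z─P₁]≡⁅c′⁆ : C₂ ─ (Z ─ P₁) ≡ ⁅ c′ ⁆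
      C₂─[Z─P₁]≡⁅c′⁆ = proj₂ (proj₂ at)
      ρ′ : Vec (Subset n) 7
      ρ′ = ρ Z c c′
      fs : List (Fact ρ′)
      fs = (p₁ ─′ z ∩′ p₁ ≐ ĉ , P₁─Z∩P₁≡⁅c⁆) ∷ (z ─′ p₁ ⊑ c₂ , Z─P₁⊆C₂)
         ∷ (c₂ ─′ (z ─′ p₁) ≐ ĉ′ , C₂─[Z─P₁]≡⁅c′⁆) ∷ (ı ⊑ z , x∈p⇒⁅x⁆⊆p i∈Z) ∷ chord

    AdjacentAt-swap : AdjacentAt P₂ C₁ Z c′ c
    AdjacentAt-swap =
      prove ρ′ fs (p₂ ─′ z ∩′ p₂ ≐ ĉ′) , prove ρ′ fs (z ─′ p₂ ⊑ c₁) , prove ρ′ fs (c₁ ─′ (z ─′ p₂) ≐ ĉ)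

    AdjacentAt-exponent : adjacency-exponent P₁ P₂ C₂ Z ≡ decomposed-exponent (Z ∩ P₁) (Z ∩ P₂) c c′ i
    AdjacentAt-exponent = sign-exponent-cong {A = Z ∩ P₁}
      (prove ρ′ fs (z ─′ p₁ ≐ z ∩′ p₂ ∪′ ı)) P₁─Z∩P₁≡⁅c⁆
      (prove ρ′ fs (z ∩′ p₁ ∪′ p₂ ≐ z ∩′ p₁ ∪′ (z ∩′ p₂ ∪′ ĉ′)))
      (prove ρ′ fs (p₂ ≐ z ∩′ p₂ ∪′ ĉ′)) (prove ρ′ fs (c₂ ─′ p₂ ≐ ı)) C₂─[Z─P₁]≡⁅c′⁆

    AdjacentAt-separated : Separated (Z ∩ P₁) (Z ∩ P₂) c c′ i
    AdjacentAt-separated = record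
      { A∩B  = prove ρ′ fs ((z ∩′ p₁) ∩′ (z ∩′ p₂) ≐ ∅)
      ; A∩c  = prove ρ′ fs ((z ∩′ p₁) ∩′ ĉ ≐ ∅)
      ; A∩c′ = prove ρ′ fs ((z ∩′ p₁) ∩′ ĉ′ ≐ ∅)
      ; A∩i  = prove ρ′ fs ((z ∩′ p₁) ∩′ ı ≐ ∅)
      ; B∩c  = prove ρ′ fs ((z ∩′ p₂) ∩′ ĉ ≐ ∅)
      ; B∩c′ = prove ρ′ fs ((z ∩′ p₂) ∩′ ĉ′ ≐ ∅)
      ; B∩i  = prove ρ′ fs ((z ∩′ p₂) ∩′ ı ≐ ∅)
      ; c∩c′ = prove ρ′ fs (ĉ ∩′ ĉ′ ≐ ∅)
      ; c∩i  = prove ρ′ fs (ĉ ∩′ ı ≐ ∅)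
      ; c′∩i = prove ρ′ fs (ĉ′ ∩′ ı ≐ ∅)
      }

  P₁⊆C : P₁ ⊆ C
  P₁⊆C = prove (ρ C i i) chord (p₁ ⊑ cc)

  C─P₁⋖C₂ : C ─ P₁ ⋖ C₂
  C─P₁⋖C₂ = ─≡⁅x⁆⇒⋖ {x = i} (prove (ρ C i i) chord (cc ─′ p₁ ⊑ c₂))
                             (prove (ρ C i i) chord (c₂ ─′ (cc ─′ p₁) ≐ ı))

  P₁⊆Z∧i∈Z⇒C₁⊆Z : ∀ {Z} → P₁ ⊆ Z → i ∈ Z → C₁ ⊆ Z
  P₁⊆Z∧i∈Z⇒C₁⊆Z {Z} P₁⊆Z i∈Z =
    prove (ρ Z i i) ((p₁ ⊑ z , P₁⊆Z) ∷ (ı ⊑ z , x∈p⇒⁅x⁆⊆p i∈Z) ∷ chord) (c₁ ⊑ z)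

  P₁⊆Z∧Z─P₁⋖C₂⇒Z≡C : ∀ {Z} → P₁ ⊆ Z → i ∉ Z → Z ─ P₁ ⋖ C₂ → Z ≡ C
  P₁⊆Z∧Z─P₁⋖C₂⇒Z≡C {Z} P₁⊆Z i∉Z Z─P₁⋖C₂@(Z─P₁⊆C₂ , _) =
    prove (ρ Z i i) (C₂─[Z─P₁]≡⁅i⁆-fact ∷ fs) (z ≐ cc)
    where
    fs : List (Fact (ρ Z i i))
    fs = (p₁ ⊑ z , P₁⊆Z) ∷ (z ─′ p₁ ⊑ c₂ , Z─P₁⊆C₂) ∷ (ı ∩′ z ≐ ∅ , x∉p⇒⁅x⁆∩p≡⊥ Z i∉Z) ∷ chord
    C₂─[Z─P₁]≡⁅i⁆-fact : Fact (ρ Z i i)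
    C₂─[Z─P₁]≡⁅i⁆-fact = c₂ ─′ (z ─′ p₁) ≐ ı ,
      ⋖∧x∈p─q⇒─≡⁅x⁆ Z─P₁⋖C₂ (⁅x⁆⊆p⇒x∈p (prove (ρ Z i i) fs (ı ⊑ c₂ ─′ (z ─′ p₁))))

module ChordAlgebra {c ℓ} (𝕂 : Field c ℓ) {n : ℕ} where
  open Field 𝕂 renaming (refl to ≈-refl; sym to ≈-sym; trans to ≈-trans)
  open Exterior 𝕂 n
  open ExteriorCalculus 𝕂 n
  open import Relation.Binary.Reasoning.Setoid setoid

  module Generator (P Q X : Subset n) (P∩X≡⊥ : P ∩ X ≡ ⊥) where

    -- The last two signs cancel those produced by the product with ∂ e_X, so that at a facet
    -- C ─ ⁅ c ⁆ with c ∈ P the generator has the coefficient of ∂ e_C (see facet-exponent).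
    cofactor : 𝓔
    cofactor A = if A ⋖ᵇ P then sgn (inv (P ─ A) (A ∪ Q)) * (sgn (inv A Q) * sgn (inv (X ─ Q) Q)) else 0#

    generator : 𝓔
    generator = cofactor ∧ ∂ (e X)

    generator-at : ∀ Z → generator Z ≈ sgn (inv (Z ∩ P) (Z ─ P)) * (cofactor (Z ∩ P) * ∂ (e X) (Z ─ P))
    generator-at Z = ≈-trans (∧-expand cofactor (∂ (e X)) Z) (≈-trans (Σ-over-single (Z ∩ P) _ off-Z∩P)
      (reflexive (≡.trans (if-reflects-true (subsetᵇ-reflects (Z ∩ P) Z) (p∩q⊆p Z P))
                          (cong (λ D → sgn (inv (Z ∩ P) D) * (cofactor (Z ∩ P) * ∂ (e X) D)) Z─[Z∩P]≡Z─P))))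
      where
      ρ : Subset n → Vec (Subset n) 4
      ρ A = P ∷ X ∷ Z ∷ A ∷ []
      p x z a : Expr 4
      p = var (# 0); x = var (# 1); z = var (# 2); a = var (# 3)

      Z─[Z∩P]≡Z─P : Z ─ (Z ∩ P) ≡ Z ─ P
      Z─[Z∩P]≡Z─P = prove (ρ Z) [] (z ─′ z ∩′ p ≐ z ─′ p)

      off-Z∩P : ∀ A → A ≢ Z ∩ P → ∧-term cofactor (∂ (e X)) Z A ≈ 0#
      off-Z∩P A A≢Z∩P with subsetᵇ A Z | subsetᵇ-reflects A Z
      ... | false | ofⁿ _   = ≈-refl
      ... | true  | ofʸ A⊆Z = ≈-trans (*-congˡ (*-congˡ (∂-e X (Z ─ A))))
        (≈-trans (*-congˡ (if*if≈0 (⋖-reflects A P) (⋖-reflects (Z ─ A) X) not-both)) (zeroʳ _))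
        where
        not-both : ¬ (A ⋖ P × Z ─ A ⋖ X)
        not-both ((A⊆P , _) , (Z─A⊆X , _)) = A≢Z∩P (prove (ρ A)
          ((a ⊑ z , A⊆Z) ∷ (a ⊑ p , A⊆P) ∷ (z ─′ a ⊑ x , Z─A⊆X) ∷ (p ∩′ x ≐ ∅ , P∩X≡⊥) ∷ []) (a ≐ z ∩′ p))

    generator-adjacent : ∀ {Z} → Adjacent P X Z → generator Z ≈ sgn (adjacency-exponent P Q X Z)
    generator-adjacent {Z} (Z∩P⋖P , Z─P⋖X) = begin
      generator Z
        ≈⟨ generator-at Z ⟩
      sgn (inv A (Z ─ P)) * (cofactor A * ∂ (e X) (Z ─ P))
        ≈⟨ *-congˡ (*-cong (reflexive (if-reflects-true (⋖-reflects A P) Z∩P⋖P)) (∂-e-⋖ Z─P⋖X)) ⟩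
      sgn (inv A (Z ─ P)) * ((sgn (inv (P ─ A) (A ∪ Q)) * (sgn (inv A Q) * sgn (inv (X ─ Q) Q))) * sgn (inv (X ─ (Z ─ P)) (Z ─ P)))
        ≈⟨ sgn-product (inv A (Z ─ P)) (inv (P ─ A) (A ∪ Q)) (inv A Q) (inv (X ─ Q) Q) (inv (X ─ (Z ─ P)) (Z ─ P)) ⟩
      sgn (adjacency-exponent P Q X Z) ∎
      where
      A : Subset n
      A = Z ∩ P

    generator-nonadjacent : ∀ {Z} → ¬ Adjacent P X Z → generator Z ≈ 0#
    generator-nonadjacent {Z} ¬adj = ≈-trans (generator-at Z) (≈-trans (*-congˡ (*-congˡ (∂-e X (Z ─ P))))
      (≈-trans (*-congˡ (if*if≈0 (⋖-reflects (Z ∩ P) P) (⋖-reflects (Z ─ P) X) ¬adj)) (zeroʳ _)))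

  module ChordSide (C₁ C₂ : Subset n) (i : Fin n) (C : Subset n)
                   (C₁∩C₂≡⁅i⁆ : C₁ ∩ C₂ ≡ ⁅ i ⁆) (C≡C₁ΔC₂ : C ≡ C₁ Δ C₂) where
    open ChordSets C₁ C₂ i C C₁∩C₂≡⁅i⁆ C≡C₁ΔC₂ public
    open Generator P₁ P₂ C₂ P₁∩C₂≡⊥ public

    generator-facet : ∀ {Z c} → Z ⊆ C → C ─ Z ≡ ⁅ c ⁆ → c ∈ C₁ → generator Z ≈ sgn (inv (C ─ Z) Z)
    generator-facet {Z} Z⊆C C─Z≡⁅c⁆ c∈C₁ with facet-exponent Z⊆C C─Z≡⁅c⁆ c∈C₁
    ... | k , exponent≡ = ≈-trans (generator-adjacent (facet-adjacent Z⊆C C─Z≡⁅c⁆ c∈C₁))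
                                  (≈-trans (reflexive (cong sgn exponent≡)) (sgn-+-even (inv (C ─ Z) Z) k))

    generator-facet-other : ∀ {Z c} → Z ⊆ C → C ─ Z ≡ ⁅ c ⁆ → c ∈ C₂ → generator Z ≈ 0#
    generator-facet-other Z⊆C C─Z≡⁅c⁆ c∈C₂ = generator-nonadjacent (facet-nonadjacent Z⊆C C─Z≡⁅c⁆ c∈C₂)

    generator-outside : ∀ {Z} → i ∉ Z → ¬ Z ⋖ C → generator Z ≈ 0#
    generator-outside i∉Z ¬Z⋖C = generator-nonadjacent λ adj → ¬Z⋖C (adjacent⇒⋖ i∉Z adj)

  module Chord (C₁ C₂ : Subset n) (i : Fin n) (C : Subset n)
               (C₁∩C₂≡⁅i⁆ : C₁ ∩ C₂ ≡ ⁅ i ⁆) (C≡C₁ΔC₂ : C ≡ C₁ Δ C₂) where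
    module Side₁ = ChordSide C₁ C₂ i C C₁∩C₂≡⁅i⁆ C≡C₁ΔC₂
    module Side₂ = ChordSide C₂ C₁ i C Side₁.C₂∩C₁≡⁅i⁆ Side₁.C≡C₂ΔC₁

    generators-on-facet : ∀ {Z c} → Z ⊆ C → C ─ Z ≡ ⁅ c ⁆ →
                          Side₁.generator Z + Side₂.generator Z ≈ sgn (inv (C ─ Z) Z)
    generators-on-facet {c = c} Z⊆C C─Z≡⁅c⁆ with c ∈? C₁
    ... | yes c∈C₁ = ≈-trans (+-cong (Side₁.generator-facet Z⊆C C─Z≡⁅c⁆ c∈C₁)
                                     (Side₂.generator-facet-other Z⊆C C─Z≡⁅c⁆ c∈C₁)) (+-identityʳ _)
    ... | no  c∉C₁ = ≈-trans (+-cong (Side₁.generator-facet-other Z⊆C C─Z≡⁅c⁆ c∈C₂)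
                                     (Side₂.generator-facet Z⊆C C─Z≡⁅c⁆ c∈C₂)) (+-identityˡ _)
      where
      c∈C₂ : c ∈ C₂
      c∈C₂ = Side₁.facet-side Z⊆C C─Z≡⁅c⁆ c∉C₁

    generators-cancel : ∀ {Z} → i ∈ Z → Side₁.generator Z + Side₂.generator Z ≈ 0#
    generators-cancel {Z} i∈Z with (Z ∩ Side₁.P₁ ⋖ᵇ Side₁.P₁) ∧ᵇ (Z ─ Side₁.P₁ ⋖ᵇ C₂)
                                 | ⋖-reflects (Z ∩ Side₁.P₁) Side₁.P₁ ×-reflects ⋖-reflects (Z ─ Side₁.P₁) C₂
    ... | false | ofⁿ ¬adj₁ =
      ≈-trans (+-cong (Side₁.generator-nonadjacent ¬adj₁) (Side₂.generator-nonadjacent ¬adj₂)) (+-identityʳ 0#)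
      where
      ¬adj₂ : ¬ Adjacent Side₂.P₁ C₁ Z
      ¬adj₂ adj₂ with Adjacent⇒AdjacentAt adj₂
      ... | _ , _ , at₂ = ¬adj₁ (AdjacentAt⇒Adjacent (Side₂.AdjacentAt-swap i∈Z at₂))
    ... | true  | ofʸ adj₁ with Adjacent⇒AdjacentAt adj₁
    ...   | c , c′ , at₁ = ≈-trans (+-cong G₁≈ G₂≈) (sgn-+-odd e₁ e₂ (proj₁ odd) (proj₂ odd))
      where
      A B : Subset n
      A = Z ∩ Side₁.P₁
      B = Z ∩ Side₂.P₁
      e₁ e₂ : ℕ
      e₁ = decomposed-exponent A B c c′ i
      e₂ = decomposed-exponent B A c′ c i
      at₂ : AdjacentAt Side₂.P₁ C₁ Z c′ c
      at₂ = Side₁.AdjacentAt-swap i∈Z at₁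
      odd : ∃[ K ] e₁ +ℕ e₂ ≡ suc (K +ℕ K)
      odd = decomposed-exponent-odd (Side₁.AdjacentAt-separated i∈Z at₁)
      G₁≈ : Side₁.generator Z ≈ sgn e₁
      G₁≈ = ≈-trans (Side₁.generator-adjacent adj₁) (reflexive (cong sgn (Side₁.AdjacentAt-exponent i∈Z at₁)))
      G₂≈ : Side₂.generator Z ≈ sgn e₂
      G₂≈ = ≈-trans (Side₂.generator-adjacent (AdjacentAt⇒Adjacent at₂))
                    (reflexive (cong sgn (Side₂.AdjacentAt-exponent i∈Z at₂)))

    generators-off-facet : ∀ {Z} → ¬ Z ⋖ C → Side₁.generator Z + Side₂.generator Z ≈ 0#
    generators-off-facet {Z} ¬Z⋖C with i ∈? Z
    ... | yes i∈Z = generators-cancel i∈Z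
    ... | no  i∉Z = ≈-trans (+-cong (Side₁.generator-outside i∉Z ¬Z⋖C) (Side₂.generator-outside i∉Z ¬Z⋖C))
                            (+-identityʳ 0#)

    ∂eC≋generators : ∂ (e C) ≋ λ Z → Side₁.generator Z + Side₂.generator Z
    ∂eC≋generators Z with Z ⋖ᵇ C | ⋖-reflects Z C
    ... | true  | ofʸ Z⋖C@(Z⊆C , _) =
      ≈-trans (∂-e-⋖ Z⋖C) (≈-sym (generators-on-facet Z⊆C (proj₂ (⋖⇒─≡⁅x⁆ Z⋖C))))
    ... | false | ofⁿ ¬Z⋖C = ≈-trans (∂-e-⋖̸ ¬Z⋖C) (≈-sym (generators-off-facet ¬Z⋖C))

    module _ (𝔛 : Subset n → Set) (C₁∈𝔛 : 𝔛 C₁) (C₂∈𝔛 : 𝔛 C₂) where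
      open Ideal 𝔛

      ∂eC∈ideal : InIdeal 𝔛 (∂ (e C))
      ∂eC∈ideal = InIdeal-resp-≋ ∂eC≋generators
        (InIdeal-+ (InIdeal-∧∂ Side₁.cofactor C₂∈𝔛) (InIdeal-∧∂ Side₂.cofactor C₁∈𝔛))

      eC∈ideal : InIdeal 𝔛 (e C)
      eC∈ideal = InIdeal-modulo AboveCircuit above? above-circuit (InIdeal-∧∂ (t ·e P₁) C₂∈𝔛) agree
        where
        open Side₁ using (P₁; P₁⊆C; C─P₁⋖C₂; i∈C₁; i∈C₂; P₁⊆Z∧i∈Z⇒C₁⊆Z; P₁⊆Z∧Z─P₁⋖C₂⇒Z≡C)

        AboveCircuit : Subset n → Set
        AboveCircuit W = C₁ ⊆ W ⊎ C₂ ⊆ W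

        above? : Decidable AboveCircuit
        above? W = (C₁ ⊆? W) ⊎-dec (C₂ ⊆? W)

        above-circuit : ∀ W → AboveCircuit W → ∀ d → InIdeal 𝔛 (d ·e W)
        above-circuit W (inj₁ C₁⊆W) = InIdeal-·e C₁∈𝔛 C₁⊆W i∈C₁
        above-circuit W (inj₂ C₂⊆W) = InIdeal-·e C₂∈𝔛 C₂⊆W i∈C₂

        k₁ k₂ : ℕ
        k₁ = inv P₁ (C ─ P₁)
        k₂ = inv (C₂ ─ (C ─ P₁)) (C ─ P₁)
        t : Carrier
        t = sgn k₁ * sgn k₂ * 1#

        agree : ∀ Z → ¬ AboveCircuit Z → e C Z ≈ ((t ·e P₁) ∧ ∂ (e C₂)) Z
        agree Z ¬above = ≈-sym (≈-trans (∧-expand-·eˡ t P₁ (∂ (e C₂)) Z) compare)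
          where
          compare : (if subsetᵇ P₁ Z then sgn (inv P₁ (Z ─ P₁)) * (t * ∂ (e C₂) (Z ─ P₁)) else 0#) ≈ e C Z
          compare with eqS C Z | eqS-reflects C Z
          ... | true | ofʸ refl
            rewrite if-reflects-true {x = sgn (inv P₁ (C ─ P₁)) * (t * ∂ (e C₂) (C ─ P₁))} {y = 0#}
                                     (subsetᵇ-reflects P₁ C) P₁⊆C =
            ≈-trans (*-congˡ (*-congˡ (∂-e-⋖ C─P₁⋖C₂))) (sgn-sandwich k₁ k₂ 1#)
          ... | false | ofⁿ C≢Z with subsetᵇ P₁ Z | subsetᵇ-reflects P₁ Z
          ...   | false | ofⁿ _    = ≈-refl
          ...   | true  | ofʸ P₁⊆Z =
            x*[y*u]≈0 _ _ (∂-e-⋖̸ λ Z─P₁⋖C₂ → C≢Z (≡.sym (P₁⊆Z∧Z─P₁⋖C₂⇒Z≡C P₁⊆Z i∉Z Z─P₁⋖C₂)))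
            where
            i∉Z : i ∉ Z
            i∉Z i∈Z = ¬above (inj₁ (P₁⊆Z∧i∈Z⇒C₁⊆Z P₁⊆Z i∈Z))

-- Circuits of a simple binary matroid

module CircuitFacts {n} (M : Matroid n) (simple : IsSimple M) (binary : IsBinary M) where
  open Matroid M

  3≤∣circuit∣ : ∀ {X} → IsCircuit X → 3 ≤ ∣ X ∣
  3≤∣circuit∣ {X} X-circuit with ∣ X ∣ in ∣X∣≡
  ... | 0 = ⊥-elim (empty-not-circuit (≡.subst IsCircuit (∣p∣≡0⇒p≡⊥ X ∣X∣≡) X-circuit))
  ... | 1 = ⊥-elim (proj₁ (simple X X-circuit) ∣X∣≡)
  ... | 2 = ⊥-elim (proj₂ (simple X X-circuit) ∣X∣≡)
  ... | suc (suc (suc _)) = s≤s (s≤s (s≤s z≤n))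

  circuit-nonempty : ∀ {X} → IsCircuit X → Nonempty X
  circuit-nonempty {X} X-circuit with nonempty? X
  ... | yes X-nonempty = X-nonempty
  ... | no  X-empty    = ⊥-elim (empty-not-circuit (≡.subst IsCircuit (Empty-unique X-empty) X-circuit))

  chord-circuit-smaller : ∀ {C C₁ C₂ i} → IsCircuit C₂ → C₁ ∩ C₂ ≡ ⁅ i ⁆ → C ≡ C₁ Δ C₂ →
                          ∣ C₁ ∣ ≤ ∣ C ∣ ∸ 1
  chord-circuit-smaller {C₁ = C₁} {C₂} {i} C₂-circuit C₁∩C₂≡⁅i⁆ refl =
    ℕ.suc[m]≤n⇒m≤pred[n] (ℕ.+-cancelʳ-≤ 2 (suc ∣ C₁ ∣) ∣ C₁ Δ C₂ ∣ (begin
      suc ∣ C₁ ∣ +ℕ 2       ≡⟨ ℕ.+-suc ∣ C₁ ∣ 2 ⟨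
      ∣ C₁ ∣ +ℕ 3           ≤⟨ ℕ.+-monoʳ-≤ ∣ C₁ ∣ (3≤∣circuit∣ C₂-circuit) ⟩
      ∣ C₁ ∣ +ℕ ∣ C₂ ∣       ≡⟨ ∣pΔq∣+2∣p∩q∣≡∣p∣+∣q∣ C₁ C₂ ⟨
      ∣ C₁ Δ C₂ ∣ +ℕ 2 *ℕ ∣ C₁ ∩ C₂ ∣
        ≡⟨ cong (λ k → ∣ C₁ Δ C₂ ∣ +ℕ 2 *ℕ k) (≡.trans (cong ∣_∣ C₁∩C₂≡⁅i⁆) (∣⁅x⁆∣≡1 i)) ⟩
      ∣ C₁ Δ C₂ ∣ +ℕ 2       ∎))
    where open ℕ.≤-Reasoning

  private
    singleton-not-circuit : ∀ {X i} → X ≡ ⁅ i ⁆ → ¬ IsCircuit X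
    singleton-not-circuit {i = i} refl ⁅i⁆-circuit = proj₁ (simple ⁅ i ⁆ ⁅i⁆-circuit) (∣⁅x⁆∣≡1 i)

  module _ {C} (C-circuit : IsCircuit C) where

    chord-from-single-excess : ∀ {X i} → IsCircuit X → X ─ C ≡ ⁅ i ⁆ → HasChord M C
    chord-from-single-excess {X} {i} X-circuit X─C≡⁅i⁆ = from-binary (binary X C X-circuit C-circuit X≢C)
      where
      ρ : Subset n → Subset n → Vec (Subset n) 5
      ρ D E = X ∷ C ∷ ⁅ i ⁆ ∷ D ∷ E ∷ []
      x cc ı d ε : Expr 5
      x = var (# 0); cc = var (# 1); ı = var (# 2); d = var (# 3); ε = var (# 4)
      excess : ∀ {D E} → Fact (ρ D E)
      excess = x ─′ cc ≐ ı , X─C≡⁅i⁆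

      i∈X : i ∈ X
      i∈X = ⁅x⁆⊆p⇒x∈p (prove (ρ X X) (excess ∷ []) (ı ⊑ x))

      X≢C : X ≢ C
      X≢C X≡C = ⁅x⁆∩p≡⊥⇒x∉p C (prove (ρ X X) (excess ∷ []) (ı ∩′ cc ≐ ∅)) (≡.subst (i ∈_) X≡C i∈X)

      X∩C≢⊥ : X ∩ C ≢ ⊥
      X∩C≢⊥ X∩C≡⊥ = singleton-not-circuit (prove (ρ X X) (excess ∷ (x ∩′ cc ≐ ∅ , X∩C≡⊥) ∷ []) (x ≐ ı)) X-circuit

      from-binary : ∃[ D ] IsCircuit D × D ⊆ X Δ C → HasChord M C
      from-binary (D , D-circuit , D⊆XΔC) with i ∈? D
      ... | no i∉D = ⊥-elim (X∩C≢⊥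
        (prove (ρ C C) (excess ∷ (cc ⊑ x Δ′ cc , ≡.subst (_⊆ X Δ C) D≡C D⊆XΔC) ∷ []) (x ∩′ cc ≐ ∅)))
        where
        D≡C : D ≡ C
        D≡C = incomparable D C D-circuit C-circuit
          (prove (ρ D D) (excess ∷ (d ⊑ x Δ′ cc , D⊆XΔC) ∷ (ı ∩′ d ≐ ∅ , x∉p⇒⁅x⁆∩p≡⊥ D i∉D) ∷ []) (d ⊑ cc))
      ... | yes i∈D with elimination D X i D-circuit X-circuit D≢X i∈D i∈X
        where
        D≢X : D ≢ X
        D≢X D≡X = X∩C≢⊥
          (prove (ρ X X) (excess ∷ (x ⊑ x Δ′ cc , ≡.subst (_⊆ X Δ C) D≡X D⊆XΔC) ∷ []) (x ∩′ cc ≐ ∅))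
      ...   | E , E-circuit , E⊆D∪X , i∉E =
        i , D , X , D-circuit , X-circuit , prove (ρ D C) fs (d ∩′ x ≐ ı) , prove (ρ D C) fs (cc ≐ d Δ′ x)
        where
        E≡C : E ≡ C
        E≡C = incomparable E C E-circuit C-circuit (prove (ρ D E)
          (excess ∷ (d ⊑ x Δ′ cc , D⊆XΔC) ∷ (ε ⊑ d ∪′ x , E⊆D∪X) ∷ (ı ∩′ ε ≐ ∅ , x∉p⇒⁅x⁆∩p≡⊥ E i∉E) ∷ [])
          (ε ⊑ cc))
        fs : List (Fact (ρ D C))
        fs = excess ∷ (d ⊑ x Δ′ cc , D⊆XΔC) ∷ (cc ⊑ d ∪′ x , ≡.subst (_⊆ D ∪ X) E≡C E⊆D∪X)
           ∷ (ı ⊑ d , x∈p⇒⁅x⁆⊆p i∈D) ∷ []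

    chord-from-small-circuit : ∀ {X} → IsCircuit X → ∣ X ∣ ≤ ∣ C ∣ ∸ 1 → ∣ X ─ C ∣ ≤ 1 → HasChord M C
    chord-from-small-circuit {X} X-circuit ∣X∣≤∣C∣∸1 ∣X─C∣≤1 with ∣ X ─ C ∣ in ∣X─C∣≡
    ... | 0 = ⊥-elim (∣C∣≰∣C∣∸1 (≡.subst (λ Y → ∣ Y ∣ ≤ ∣ C ∣ ∸ 1) X≡C ∣X∣≤∣C∣∸1))
      where
      X≡C : X ≡ C
      X≡C = incomparable X C X-circuit C-circuit
        (prove (X ∷ C ∷ []) ((x ─′ c ≐ ∅ , ∣p∣≡0⇒p≡⊥ (X ─ C) ∣X─C∣≡) ∷ []) (x ⊑ c))
        where
        x c : Expr 2
        x = var (# 0); c = var (# 1)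
      ∣C∣≰∣C∣∸1 : ¬ ∣ C ∣ ≤ ∣ C ∣ ∸ 1
      ∣C∣≰∣C∣∸1 with ∣ C ∣ | 3≤∣circuit∣ C-circuit
      ... | suc k | _ = ℕ.<-irrefl refl
    ... | 1 = chord-from-single-excess X-circuit (proj₂ (∣p∣≡1⇒p≡⁅x⁆ (X ─ C) ∣X─C∣≡))
    chord-from-small-circuit _ _ (s≤s ()) | suc (suc _)

  chord-circuits-small : ∀ {C C₁ C₂ i} → IsCircuit C₁ → IsCircuit C₂ → C₁ ∩ C₂ ≡ ⁅ i ⁆ → C ≡ C₁ Δ C₂ →
                         CircuitsUpTo M (∣ C ∣ ∸ 1) C₁ × CircuitsUpTo M (∣ C ∣ ∸ 1) C₂
  chord-circuits-small {C} {C₁} {C₂} {i} C₁-circuit C₂-circuit C₁∩C₂≡⁅i⁆ C≡C₁ΔC₂ =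
    (C₁-circuit , chord-circuit-smaller C₂-circuit C₁∩C₂≡⁅i⁆ C≡C₁ΔC₂) ,
    (C₂-circuit , chord-circuit-smaller C₁-circuit C₂∩C₁≡⁅i⁆ C≡C₂ΔC₁)
    where open ChordSets C₁ C₂ i C C₁∩C₂≡⁅i⁆ C≡C₁ΔC₂ using (C₂∩C₁≡⁅i⁆; C≡C₂ΔC₁)

  module _ {c ℓ} (𝕂 : Field c ℓ) {C} (C-circuit : IsCircuit C) where
    open Field 𝕂 using (_≈_; 0#)
    open Exterior 𝕂 n using (InIdeal)
    open ExteriorCalculus 𝕂 n using (module Ideal)

    nonvanishing-below⇒chord : ∀ {f Z} → InIdeal (CircuitsUpTo M (∣ C ∣ ∸ 1)) f → Z ⊆ C → ¬ (f Z ≈ 0#) → HasChord M C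
    nonvanishing-below⇒chord f∈ideal Z⊆C fZ≉0 with Ideal.InIdeal-dichotomy _ C f∈ideal
    ... | inj₁ (X , (X-circuit , ∣X∣≤∣C∣∸1) , ∣X─C∣≤1) =
      chord-from-small-circuit C-circuit X-circuit ∣X∣≤∣C∣∸1 ∣X─C∣≤1
    ... | inj₂ vanish = ⊥-elim (fZ≉0 (vanish _ Z⊆C))

proposition6 : ∀ {c ℓ : Level} (n : ℕ) (M : Matroid n) (𝕂 : Field c ℓ) →
    IsSimple M → IsBinary M →
    (C : Subset n) → Matroid.IsCircuit M C → 4 ≤ ∣ C ∣ →
    let open Exterior 𝕂 n in
    (HasChord M C ⇔ InIdeal (CircuitsUpTo M (∣ C ∣ ∸ 1)) (∂ (e C)))
      × (InIdeal (CircuitsUpTo M (∣ C ∣ ∸ 1)) (∂ (e C)) ⇔ InIdeal (CircuitsUpTo M (∣ C ∣ ∸ 1)) (e C))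
proposition6 n M 𝕂 simple binary C C-circuit _ =
  mk⇔ chord⇒∂eC ∂eC⇒chord , mk⇔ (chord⇒eC ∘ ∂eC⇒chord) (chord⇒∂eC ∘ eC⇒chord)
  where
  open Exterior 𝕂 n
  open ExteriorCalculus 𝕂 n
  open CircuitFacts M simple binary
  open ChordAlgebra 𝕂

  𝔛 : Subset n → Set
  𝔛 = CircuitsUpTo M (∣ C ∣ ∸ 1)

  chord⇒∂eC : HasChord M C → InIdeal 𝔛 (∂ (e C))
  chord⇒∂eC (i , C₁ , C₂ , C₁-circuit , C₂-circuit , C₁∩C₂≡⁅i⁆ , C≡C₁ΔC₂) =
    uncurry (Chord.∂eC∈ideal C₁ C₂ i C C₁∩C₂≡⁅i⁆ C≡C₁ΔC₂ 𝔛)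
            (chord-circuits-small C₁-circuit C₂-circuit C₁∩C₂≡⁅i⁆ C≡C₁ΔC₂)

  chord⇒eC : HasChord M C → InIdeal 𝔛 (e C)
  chord⇒eC (i , C₁ , C₂ , C₁-circuit , C₂-circuit , C₁∩C₂≡⁅i⁆ , C≡C₁ΔC₂) =
    uncurry (Chord.eC∈ideal C₁ C₂ i C C₁∩C₂≡⁅i⁆ C≡C₁ΔC₂ 𝔛)
            (chord-circuits-small C₁-circuit C₂-circuit C₁∩C₂≡⁅i⁆ C≡C₁ΔC₂)

  ∂eC⇒chord : InIdeal 𝔛 (∂ (e C)) → HasChord M C
  ∂eC⇒chord ∂eC∈ideal = let j , j∈C = circuit-nonempty C-circuit in
    nonvanishing-below⇒chord 𝕂 C-circuit ∂eC∈ideal (p─q⊆p C ⁅ j ⁆) (∂-e-facet≉0 j∈C)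

  eC⇒chord : InIdeal 𝔛 (e C) → HasChord M C
  eC⇒chord eC∈ideal = nonvanishing-below⇒chord 𝕂 C-circuit eC∈ideal ⊆-refl (e-diag≉0 C)
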